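{- For every positive integer $N$, \[ \sum_{\substack{\pi\in\mathcal{P}_{3,4}\\ |\pi|=N}} (-1)^{\nu(\pi)} = \begin{cases} 1, & \text{if $N$ is even and $(2j)^2<N<(2j+1)^2$ for some integer $j\ge 1$},\\ -1, & \text{if $N$ is odd and $(2j-1)^2<N<(2j)^2$ for some integer $j\ge 1$},\\ 0, & \text{otherwise.} \end{cases} \]
   Context: A partition is a finite non-increasing sequence of positive integers (its parts); $|\pi|$ is the sum of its parts and $\nu(\pi)$ the number of parts counted with multiplicity. $\mathcal{P}_{3,4}$ is the set of non-empty partitions in which every even part size occurs at most once (odd parts may repeat) and whose smallest part is congruent to $3$ modulo $4$. -}

module Defs where

open import Data.Nat using (ℕ; zero; suc; _+_; _*_; _^_; _≤_; _<_; _%_; _≟_; _∸_)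
open import Data.Integer as ℤ using (ℤ; 0ℤ; -1ℤ)
open import Data.List using (List; []; _∷_; length; filter; map; foldr)
open import Data.List.Relation.Unary.Linked using (Linked)
open import Data.List.Relation.Unary.All using (All)
open import Data.List.Relation.Unary.Unique.Propositional using (Unique)
open import Data.List.Membership.Propositional using (_∈_)
open import Data.Product using (_×_; ∃-syntax)
open import Relation.Binary.PropositionalEquality using (_≡_; _≢_)
open import Function.Bundles using (_⇔_)

record IsPartition (π : List ℕ) : Set where
  field
    positive    : All (λ k → 1 ≤ k) π
    nonIncrease : Linked (λ a b → b ≤ a) π

size : List ℕ → ℕ
size = foldr _+_ 0

ν : List ℕ → ℕ
ν = length

mult : ℕ → List ℕ → ℕ
mult k π = length (filter (k ≟_) π)

IsSmallestPart : ℕ → List ℕ → Set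
IsSmallestPart s π = s ∈ π × All (λ x → s ≤ x) π

record InP34 (π : List ℕ) : Set where
  field
    partition   : IsPartition π
    nonEmpty    : π ≢ []
    evenDistinct : ∀ k → k % 2 ≡ 0 → mult k π ≤ 1
    smallest    : ∃[ s ] (IsSmallestPart s π × s % 4 ≡ 3)

Enumerates34 : ℕ → List (List ℕ) → Set
Enumerates34 N ps = Unique ps × (∀ π → (π ∈ ps) ⇔ (InP34 π × size π ≡ N))

signedCount : List (List ℕ) → ℤ
signedCount ps = foldr ℤ._+_ 0ℤ (map (λ π → -1ℤ ℤ.^ ν π) ps)

CaseEven : ℕ → Set
CaseEven N = N % 2 ≡ 0 × ∃[ j ] (1 ≤ j × (2 * j) ^ 2 < N × N < (2 * j + 1) ^ 2)

CaseOdd : ℕ → Set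
CaseOdd N = N % 2 ≡ 1 × ∃[ j ] (1 ≤ j × (2 * j ∸ 1) ^ 2 < N × N < (2 * j) ^ 2)

-- Let G_s be the signed (by (-1)^ν) generating function of partitions into parts ≥ s with distinct
-- even parts. Removing one copy of the smallest part gives G_s = G_{s+1} - X^s G_{s'}, where s' = s for
-- odd s and s' = s + 1 for even s, and the generating function of 𝒫_{3,4} is -Σ_t X^{4t+3} G_{4t+3}.
-- Twice this is X W - U, where U = Σ_n X^{2n+1} G_{2n+1} and W = Σ_n (-1)^n X^{2n} G_{2n+1}.
-- The recurrences telescope to (1 + X) U = X, and rewriting W one factor at a time gives
-- (-X; X)_∞ (1 - X) W = (X; X)_∞, which by Gauss's identity (X; X)_∞ / (-X; X)_∞ = 1 + 2 Σ_{j ≥ 1} (-1)^j X^{j²}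
-- makes the coefficient of X^i in W equal to (-1)^⌊√i⌋. Hence twice the signed count at N is
-- (-1)^⌊√(N-1)⌋ - (-1)^(N-1), which gives the three cases. Everything is proved modulo X^(N+1), with
-- finite products, and Gauss's identity in a finite form that is proved by telescoping.

module Submission where

open import Defs
open import Data.Nat using (ℕ; _≤_)
open import Data.Integer using (1ℤ; -1ℤ; 0ℤ)
open import Data.List using (List)
open import Data.Product using (_×_; ∃-syntax)
open import Relation.Binary.PropositionalEquality using (_≡_)
open import Relation.Nullary using (¬_)

module PowerSeries where

  open import Data.Nat as ℕ using (ℕ; zero; suc; _≤_; _<_; z≤n; s≤s; _∸_)
  import Data.Nat.Properties as ℕP
  open import Data.Integer as ℤ using (ℤ; 0ℤ; 1ℤ; +_) renaming (_+_ to _+ᶻ_; _*_ to _*ᶻ_; -_ to -ᶻ_)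
  import Data.Integer.Properties as ℤP
  open import Data.Integer.Tactic.RingSolver using (solve-∀)
  open import Data.Maybe using (Maybe; just; nothing)
  open import Data.Product using (_,_)
  open import Function using (_∘_)
  open import Level using (0ℓ)
  open import Algebra.Bundles using (CommutativeRing)
  open import Algebra.Structures using (IsCommutativeRing)
  open import Algebra.Solver.Ring.AlmostCommutativeRing
    using (fromCommutativeRing; _-Raw-AlmostCommutative⟶_)
  import Algebra.Solver.Ring
  open import Relation.Binary.PropositionalEquality
  import Relation.Binary.Reasoning.Setoid
  open import Relation.Nullary using (yes; no; contradiction)
  open import Data.Nat.Induction using (<-rec)

  Series : Set
  Series = ℕ → ℤ

  infix 4 _≈_
  _≈_ : Series → Series → Set
  f ≈ g = ∀ n → f n ≡ g n

  infixl 6 _⊕_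
  infixl 7 _⊛_
  infix 8 ⊖_

  _⊕_ : Series → Series → Series
  (f ⊕ g) n = f n +ᶻ g n

  ⊖_ : Series → Series
  (⊖ f) n = -ᶻ f n

  𝟘 : Series
  𝟘 _ = 0ℤ

  const : ℤ → Series
  const c zero    = c
  const c (suc _) = 0ℤ

  𝟙 : Series
  𝟙 = const 1ℤ

  -- The Cauchy product Σ_{i+j=n} fᵢ gⱼ, unfolded on the first factor.
  _⊛_ : Series → Series → Series
  (f ⊛ g) zero    = f 0 *ᶻ g 0
  (f ⊛ g) (suc n) = f 0 *ᶻ g (suc n) +ᶻ ((f ∘ suc) ⊛ g) n

  ≈-refl : ∀ {f} → f ≈ f
  ≈-refl n = refl

  ≈-sym : ∀ {f g} → f ≈ g → g ≈ f
  ≈-sym p n = sym (p n)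

  ≈-trans : ∀ {f g h} → f ≈ g → g ≈ h → f ≈ h
  ≈-trans p q n = trans (p n) (q n)

  ≡⇒≈ : ∀ {f g} → f ≡ g → f ≈ g
  ≡⇒≈ refl = ≈-refl

  ⊕-cong : ∀ {f f′ g g′} → f ≈ f′ → g ≈ g′ → f ⊕ g ≈ f′ ⊕ g′
  ⊕-cong p q n = cong₂ _+ᶻ_ (p n) (q n)

  ⊖-cong : ∀ {f f′} → f ≈ f′ → ⊖ f ≈ ⊖ f′
  ⊖-cong p n = cong -ᶻ_ (p n)

  ⊛-cong : ∀ {f f′ g g′} → f ≈ f′ → g ≈ g′ → f ⊛ g ≈ f′ ⊛ g′
  ⊛-cong p q zero    = cong₂ _*ᶻ_ (p 0) (q 0)
  ⊛-cong p q (suc n) = cong₂ _+ᶻ_ (cong₂ _*ᶻ_ (p 0) (q (suc n))) (⊛-cong (p ∘ suc) q n)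

  ⊛-zeroˡ : ∀ g → 𝟘 ⊛ g ≈ 𝟘
  ⊛-zeroˡ g zero    = refl
  ⊛-zeroˡ g (suc n) = cong (0ℤ +ᶻ_) (⊛-zeroˡ g n)

  const-⊛ : ∀ c f n → (const c ⊛ f) n ≡ c *ᶻ f n
  const-⊛ c f zero    = refl
  const-⊛ c f (suc n) = trans (cong (c *ᶻ f (suc n) +ᶻ_) (⊛-zeroˡ f n)) (ℤP.+-identityʳ _)

  ⊛-identityˡ : ∀ f → 𝟙 ⊛ f ≈ f
  ⊛-identityˡ f n = trans (const-⊛ 1ℤ f n) (ℤP.*-identityˡ (f n))

  ⊛-distribʳ : ∀ f g h → (f ⊕ g) ⊛ h ≈ f ⊛ h ⊕ g ⊛ h
  ⊛-distribʳ f g h zero    = ℤP.*-distribʳ-+ (h 0) (f 0) (g 0)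
  ⊛-distribʳ f g h (suc n) = begin
      (f 0 +ᶻ g 0) *ᶻ h (suc n) +ᶻ ((f ∘ suc ⊕ g ∘ suc) ⊛ h) n
    ≡⟨ cong₂ _+ᶻ_ (ℤP.*-distribʳ-+ (h (suc n)) (f 0) (g 0)) (⊛-distribʳ (f ∘ suc) (g ∘ suc) h n) ⟩
      (f 0 *ᶻ h (suc n) +ᶻ g 0 *ᶻ h (suc n)) +ᶻ (((f ∘ suc) ⊛ h) n +ᶻ ((g ∘ suc) ⊛ h) n)
    ≡⟨ interchange (f 0 *ᶻ h (suc n)) (g 0 *ᶻ h (suc n)) (((f ∘ suc) ⊛ h) n) (((g ∘ suc) ⊛ h) n) ⟩
      (f 0 *ᶻ h (suc n) +ᶻ ((f ∘ suc) ⊛ h) n) +ᶻ (g 0 *ᶻ h (suc n) +ᶻ ((g ∘ suc) ⊛ h) n)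
    ∎ where
      open ≡-Reasoning
      interchange : ∀ a b c d → (a +ᶻ b) +ᶻ (c +ᶻ d) ≡ (a +ᶻ c) +ᶻ (b +ᶻ d)
      interchange = solve-∀

  ⊛-sucʳ : ∀ f g n → (f ⊛ g) (suc n) ≡ (f ⊛ (g ∘ suc)) n +ᶻ f (suc n) *ᶻ g 0
  ⊛-sucʳ f g zero    = refl
  ⊛-sucʳ f g (suc n) = begin
      f 0 *ᶻ g (suc (suc n)) +ᶻ ((f ∘ suc) ⊛ g) (suc n)
    ≡⟨ cong (f 0 *ᶻ g (suc (suc n)) +ᶻ_) (⊛-sucʳ (f ∘ suc) g n) ⟩
      f 0 *ᶻ g (suc (suc n)) +ᶻ (((f ∘ suc) ⊛ (g ∘ suc)) n +ᶻ f (suc (suc n)) *ᶻ g 0)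
    ≡⟨ ℤP.+-assoc (f 0 *ᶻ g (suc (suc n))) _ _ ⟨
      f 0 *ᶻ g (suc (suc n)) +ᶻ ((f ∘ suc) ⊛ (g ∘ suc)) n +ᶻ f (suc (suc n)) *ᶻ g 0
    ∎ where open ≡-Reasoning

  ⊛-comm : ∀ f g → f ⊛ g ≈ g ⊛ f
  ⊛-comm f g zero    = ℤP.*-comm (f 0) (g 0)
  ⊛-comm f g (suc n) = begin
      f 0 *ᶻ g (suc n) +ᶻ ((f ∘ suc) ⊛ g) n
    ≡⟨ cong₂ _+ᶻ_ (ℤP.*-comm (f 0) (g (suc n))) (⊛-comm (f ∘ suc) g n) ⟩
      g (suc n) *ᶻ f 0 +ᶻ (g ⊛ (f ∘ suc)) n
    ≡⟨ ℤP.+-comm (g (suc n) *ᶻ f 0) _ ⟩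
      (g ⊛ (f ∘ suc)) n +ᶻ g (suc n) *ᶻ f 0
    ≡⟨ ⊛-sucʳ g f n ⟨
      (g ⊛ f) (suc n)
    ∎ where open ≡-Reasoning

  scale : ℤ → Series → Series
  scale c f n = c *ᶻ f n

  ⊛-scaleˡ : ∀ c f g → scale c f ⊛ g ≈ scale c (f ⊛ g)
  ⊛-scaleˡ c f g zero    = ℤP.*-assoc c (f 0) (g 0)
  ⊛-scaleˡ c f g (suc n) = begin
      c *ᶻ f 0 *ᶻ g (suc n) +ᶻ (scale c (f ∘ suc) ⊛ g) n
    ≡⟨ cong₂ _+ᶻ_ (ℤP.*-assoc c (f 0) (g (suc n))) (⊛-scaleˡ c (f ∘ suc) g n) ⟩
      c *ᶻ (f 0 *ᶻ g (suc n)) +ᶻ c *ᶻ ((f ∘ suc) ⊛ g) n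
    ≡⟨ ℤP.*-distribˡ-+ c _ _ ⟨
      c *ᶻ (f 0 *ᶻ g (suc n) +ᶻ ((f ∘ suc) ⊛ g) n)
    ∎ where open ≡-Reasoning

  ⊛-assoc : ∀ f g h → (f ⊛ g) ⊛ h ≈ f ⊛ (g ⊛ h)
  ⊛-assoc f g h zero    = ℤP.*-assoc (f 0) (g 0) (h 0)
  ⊛-assoc f g h (suc n) = begin
      (f 0 *ᶻ g 0) *ᶻ h (suc n) +ᶻ ((scale (f 0) (g ∘ suc) ⊕ (f ∘ suc) ⊛ g) ⊛ h) n
    ≡⟨ cong ((f 0 *ᶻ g 0) *ᶻ h (suc n) +ᶻ_) (⊛-distribʳ (scale (f 0) (g ∘ suc)) ((f ∘ suc) ⊛ g) h n) ⟩
      (f 0 *ᶻ g 0) *ᶻ h (suc n) +ᶻ ((scale (f 0) (g ∘ suc) ⊛ h) n +ᶻ (((f ∘ suc) ⊛ g) ⊛ h) n)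
    ≡⟨ cong₂ (λ a b → (f 0 *ᶻ g 0) *ᶻ h (suc n) +ᶻ (a +ᶻ b)) (⊛-scaleˡ (f 0) (g ∘ suc) h n) (⊛-assoc (f ∘ suc) g h n) ⟩
      (f 0 *ᶻ g 0) *ᶻ h (suc n) +ᶻ (f 0 *ᶻ ((g ∘ suc) ⊛ h) n +ᶻ ((f ∘ suc) ⊛ (g ⊛ h)) n)
    ≡⟨ regroup (f 0) (g 0) (h (suc n)) (((g ∘ suc) ⊛ h) n) (((f ∘ suc) ⊛ (g ⊛ h)) n) ⟩
      f 0 *ᶻ (g 0 *ᶻ h (suc n) +ᶻ ((g ∘ suc) ⊛ h) n) +ᶻ ((f ∘ suc) ⊛ (g ⊛ h)) n
    ∎ where
      open ≡-Reasoning
      regroup : ∀ a b c d e → (a *ᶻ b) *ᶻ c +ᶻ (a *ᶻ d +ᶻ e) ≡ a *ᶻ (b *ᶻ c +ᶻ d) +ᶻ e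
      regroup = solve-∀

  ⊛-isCommutativeRing : IsCommutativeRing _≈_ _⊕_ _⊛_ ⊖_ 𝟘 𝟙
  ⊛-isCommutativeRing = record
    { isRing = record
      { +-isAbelianGroup = record
        { isGroup = record
          { isMonoid = record
            { isSemigroup = record
              { isMagma = record
                { isEquivalence = record { refl = ≈-refl ; sym = ≈-sym ; trans = ≈-trans }
                ; ∙-cong = ⊕-cong }
              ; assoc = λ f g h n → ℤP.+-assoc (f n) (g n) (h n) }
            ; identity = (λ f n → ℤP.+-identityˡ (f n)) , (λ f n → ℤP.+-identityʳ (f n)) }
          ; inverse = (λ f n → ℤP.+-inverseˡ (f n)) , (λ f n → ℤP.+-inverseʳ (f n))
          ; ⁻¹-cong = ⊖-cong }
        ; comm = λ f g n → ℤP.+-comm (f n) (g n) }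
      ; *-cong = ⊛-cong
      ; *-assoc = ⊛-assoc
      ; *-identity = ⊛-identityˡ , (λ f → ≈-trans (⊛-comm f 𝟙) (⊛-identityˡ f))
      ; distrib = (λ f g h → ≈-trans (⊛-comm f (g ⊕ h))
                     (≈-trans (⊛-distribʳ g h f) (⊕-cong (⊛-comm g f) (⊛-comm h f))))
                , (λ h f g → ⊛-distribʳ f g h)
      }
    ; *-comm = ⊛-comm
    }

  seriesRing : CommutativeRing 0ℓ 0ℓ
  seriesRing = record { isCommutativeRing = ⊛-isCommutativeRing }

  open CommutativeRing seriesRing public using ()
    renaming ( +-congˡ to ⊕-congˡ; +-congʳ to ⊕-congʳ; *-congˡ to ⊛-congˡ; *-congʳ to ⊛-congʳ
             ; +-identityˡ to ⊕-identityˡ; -‿inverseʳ to ⊖-inverseʳ; zeroʳ to ⊛-zeroʳ; *-identityʳ to ⊛-identityʳ)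

  module ≈-Reasoning = Relation.Binary.Reasoning.Setoid (CommutativeRing.setoid seriesRing)

  const-homomorphism : CommutativeRing.rawRing ℤP.+-*-commutativeRing -Raw-AlmostCommutative⟶ fromCommutativeRing seriesRing
  const-homomorphism = record
    { ⟦_⟧ = const
    ; +-homo = λ { a b zero → refl ; a b (suc n) → refl }
    ; *-homo = λ { a b zero → refl ; a b (suc n) → sym (trans (const-⊛ a (const b) (suc n)) (ℤP.*-zeroʳ a)) }
    ; -‿homo = λ { a zero → refl ; a (suc n) → refl }
    ; 0-homo = λ { zero → refl ; (suc n) → refl }
    ; 1-homo = λ { zero → refl ; (suc n) → refl }
    }

  const≟ : ∀ a b → Maybe (const a ≈ const b)
  const≟ a b with a ℤ.≟ b
  ... | yes refl = just ≈-refl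
  ... | no _     = nothing

  open Algebra.Solver.Ring (CommutativeRing.rawRing ℤP.+-*-commutativeRing) (fromCommutativeRing seriesRing)
    const-homomorphism const≟ public
    using (solve; _:+_; _:*_; _:-_; :-_; _:=_; con)

  X^_ : ℕ → Series
  (X^ zero)  = 𝟙
  (X^ suc k) zero    = 0ℤ
  (X^ suc k) (suc n) = (X^ k) n

  shift : ℕ → Series → Series
  shift zero    f = f
  shift (suc k) f zero    = 0ℤ
  shift (suc k) f (suc n) = shift k f n

  X^⊛≈shift : ∀ k f → X^ k ⊛ f ≈ shift k f
  X^⊛≈shift zero    f         = ⊛-identityˡ f
  X^⊛≈shift (suc k) f zero    = ℤP.*-zeroˡ (f 0)
  X^⊛≈shift (suc k) f (suc n) = trans (ℤP.+-identityˡ _) (X^⊛≈shift k f n)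

  shift-below : ∀ c f n → n < c → shift c f n ≡ 0ℤ
  shift-below (suc c) f zero    _         = refl
  shift-below (suc c) f (suc n) (s≤s n<c) = shift-below c f n n<c

  shift-above : ∀ c f n → c ≤ n → shift c f n ≡ f (n ∸ c)
  shift-above zero    f n       _         = refl
  shift-above (suc c) f (suc n) (s≤s c≤n) = shift-above c f n c≤n

  X^-cong : ∀ {a b} → a ≡ b → X^ a ≈ X^ b
  X^-cong refl = ≈-refl

  X^-+ : ∀ a b → X^ a ⊛ X^ b ≈ X^ (a ℕ.+ b)
  X^-+ a b = ≈-trans (X^⊛≈shift a (X^ b)) (shift-X^ a)
    where
    shift-X^ : ∀ a → shift a (X^ b) ≈ X^ (a ℕ.+ b)
    shift-X^ zero             = ≈-refl
    shift-X^ (suc a) zero     = refl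
    shift-X^ (suc a) (suc n)  = shift-X^ a n

  X^-diagonal : ∀ k → (X^ k) k ≡ 1ℤ
  X^-diagonal zero    = refl
  X^-diagonal (suc k) = X^-diagonal k

  X^-offDiagonal : ∀ k n → n ≢ k → (X^ k) n ≡ 0ℤ
  X^-offDiagonal zero    zero    n≢k = contradiction refl n≢k
  X^-offDiagonal zero    (suc n) _   = refl
  X^-offDiagonal (suc k) zero    _   = refl
  X^-offDiagonal (suc k) (suc n) n≢k = X^-offDiagonal k n (n≢k ∘ cong suc)

  -- congruence modulo X^(N+1)
  infix 4 _≈[_]_
  _≈[_]_ : Series → ℕ → Series → Set
  f ≈[ N ] g = ∀ n → n ≤ N → f n ≡ g n

  ≈⇒≈[] : ∀ {f g N} → f ≈ g → f ≈[ N ] g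
  ≈⇒≈[] p n _ = p n

  ≈[]-refl : ∀ {f N} → f ≈[ N ] f
  ≈[]-refl n _ = refl

  ≈[]-sym : ∀ {f g N} → f ≈[ N ] g → g ≈[ N ] f
  ≈[]-sym p n n≤N = sym (p n n≤N)

  ≈[]-trans : ∀ {f g h N} → f ≈[ N ] g → g ≈[ N ] h → f ≈[ N ] h
  ≈[]-trans p q n n≤N = trans (p n n≤N) (q n n≤N)

  ≈[]-mono : ∀ {f g M N} → M ≤ N → f ≈[ N ] g → f ≈[ M ] g
  ≈[]-mono M≤N p n n≤M = p n (ℕP.≤-trans n≤M M≤N)

  ⊕-cong[] : ∀ {f f′ g g′ N} → f ≈[ N ] f′ → g ≈[ N ] g′ → f ⊕ g ≈[ N ] f′ ⊕ g′
  ⊕-cong[] p q n n≤N = cong₂ _+ᶻ_ (p n n≤N) (q n n≤N)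

  ⊖-cong[] : ∀ {f f′ N} → f ≈[ N ] f′ → ⊖ f ≈[ N ] ⊖ f′
  ⊖-cong[] p n n≤N = cong -ᶻ_ (p n n≤N)

  ⊛-cong[] : ∀ {f f′ g g′ N} → f ≈[ N ] f′ → g ≈[ N ] g′ → f ⊛ g ≈[ N ] f′ ⊛ g′
  ⊛-cong[] {N = N} p q zero    _   = cong₂ _*ᶻ_ (p 0 z≤n) (q 0 z≤n)
  ⊛-cong[] {N = N} p q (suc n) n<N = cong₂ _+ᶻ_ (cong₂ _*ᶻ_ (p 0 z≤n) (q (suc n) n<N))
    (⊛-cong[] {N = n} (λ i i≤n → p (suc i) (ℕP.≤-trans (s≤s i≤n) n<N)) (λ i i≤n → q i (ℕP.≤-trans i≤n (ℕP.<⇒≤ n<N))) n ℕP.≤-refl)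

  ⊕-𝟘[] : ∀ {f g N} → g ≈[ N ] 𝟘 → f ⊕ g ≈[ N ] f
  ⊕-𝟘[] {f} p n n≤N = trans (cong (f n +ᶻ_) (p n n≤N)) (ℤP.+-identityʳ (f n))

  X^⊛-cong[] : ∀ c {f g N} → f ≈[ N ] g → X^ c ⊛ f ≈[ c ℕ.+ N ] X^ c ⊛ g
  X^⊛-cong[] c {f} {g} p n n≤ = trans (X^⊛≈shift c f n) (trans (shift-cong[] c p n n≤) (sym (X^⊛≈shift c g n)))
    where
    shift-cong[] : ∀ c {N} → f ≈[ N ] g → shift c f ≈[ c ℕ.+ N ] shift c g
    shift-cong[] zero    p = p
    shift-cong[] (suc c) p zero    _         = refl
    shift-cong[] (suc c) p (suc n) (s≤s n≤) = shift-cong[] c p n n≤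

  X^⊛≈[]𝟘 : ∀ c f N → N < c → X^ c ⊛ f ≈[ N ] 𝟘
  X^⊛≈[]𝟘 c f N N<c n n≤N = trans (X^⊛≈shift c f n) (shift-below c f n (ℕP.≤-<-trans n≤N N<c))

  X^≈[]𝟘 : ∀ c N → N < c → X^ c ≈[ N ] 𝟘
  X^≈[]𝟘 c N N<c = ≈[]-trans (≈⇒≈[] (≈-sym (≈-trans (⊛-comm (X^ c) 𝟙) (⊛-identityˡ (X^ c))))) (X^⊛≈[]𝟘 c 𝟙 N N<c)

  ⊛-cancelˡ[] : ∀ {h f N} → h 0 ≡ 1ℤ → h ⊛ f ≈[ N ] 𝟘 → f ≈[ N ] 𝟘
  ⊛-cancelˡ[] {h} {f} {N} h₀≡1 hf≈0 = <-rec (λ n → n ≤ N → f n ≡ 0ℤ) (λ n below n≤N → step n n≤N (λ i i<n → below i<n (ℕP.≤-trans (ℕP.<⇒≤ i<n) n≤N)))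
    where
    leading : ∀ n f → (∀ i → i < n → f i ≡ 0ℤ) → (f ⊛ h) n ≡ f n *ᶻ h 0
    leading zero    f _     = refl
    leading (suc n) f below = begin
        f 0 *ᶻ h (suc n) +ᶻ ((f ∘ suc) ⊛ h) n
      ≡⟨ cong₂ _+ᶻ_ (cong (_*ᶻ h (suc n)) (below 0 (s≤s z≤n))) (leading n (f ∘ suc) (λ i i<n → below (suc i) (s≤s i<n))) ⟩
        0ℤ *ᶻ h (suc n) +ᶻ f (suc n) *ᶻ h 0
      ≡⟨ cong (_+ᶻ f (suc n) *ᶻ h 0) (ℤP.*-zeroˡ (h (suc n))) ⟩
        0ℤ +ᶻ f (suc n) *ᶻ h 0
      ≡⟨ ℤP.+-identityˡ _ ⟩
        f (suc n) *ᶻ h 0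
      ∎ where open ≡-Reasoning
    step : ∀ n → n ≤ N → (∀ i → i < n → f i ≡ 0ℤ) → f n ≡ 0ℤ
    step n n≤N below = begin
        f n               ≡⟨ ℤP.*-identityʳ (f n) ⟨
        f n *ᶻ 1ℤ         ≡⟨ cong (f n *ᶻ_) h₀≡1 ⟨
        f n *ᶻ h 0        ≡⟨ leading n f below ⟨
        (f ⊛ h) n         ≡⟨ ⊛-comm f h n ⟩
        (h ⊛ f) n         ≡⟨ hf≈0 n n≤N ⟩
        0ℤ                ∎ where open ≡-Reasoning

  const-neg : ∀ a → const (-ᶻ a) ≈ ⊖ const a
  const-neg a zero    = refl
  const-neg a (suc n) = refl

  sumBelow : ℕ → (ℕ → Series) → Series
  sumBelow zero    F = 𝟘
  sumBelow (suc K) F = sumBelow K F ⊕ F K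

  sumBelow-cong[] : ∀ K {F G N} → (∀ i → i < K → F i ≈[ N ] G i) → sumBelow K F ≈[ N ] sumBelow K G
  sumBelow-cong[] zero    p = ≈[]-refl
  sumBelow-cong[] (suc K) p = ⊕-cong[] (sumBelow-cong[] K (λ i i<K → p i (ℕP.m≤n⇒m≤1+n i<K))) (p K ℕP.≤-refl)


  const⊛X^-diagonal : ∀ a k → (const a ⊛ X^ k) k ≡ a
  const⊛X^-diagonal a k = trans (const-⊛ a (X^ k) k) (trans (cong (a *ᶻ_) (X^-diagonal k)) (ℤP.*-identityʳ a))

  const⊛X^-offDiagonal : ∀ a k n → n ≢ k → (const a ⊛ X^ k) n ≡ 0ℤ
  const⊛X^-offDiagonal a k n n≢k = trans (const-⊛ a (X^ k) n) (trans (cong (a *ᶻ_) (X^-offDiagonal k n n≢k)) (ℤP.*-zeroʳ a))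

module GaussIdentity where

  open PowerSeries
  open import Data.Nat as ℕ using (ℕ; zero; suc; _≤_; _<_; _∸_)
  import Data.Nat.Properties as ℕP
  open import Data.Nat.Tactic.RingSolver using () renaming (solve to ℕ-solve)
  open import Data.List using ([]; _∷_)
  open import Data.Integer as ℤ using (ℤ; 0ℤ; 1ℤ; +_) renaming (-_ to -ᶻ_)
  import Data.Integer.Properties as ℤP
  open import Relation.Binary.PropositionalEquality as ≡ using (_≡_; refl)
  open ≈-Reasoning

  1-X^_ : ℕ → Series
  1-X^ a = 𝟙 ⊕ ⊖ X^ a

  1+X^_ : ℕ → Series
  1+X^ a = 𝟙 ⊕ X^ a

  sgn : ℕ → ℤ
  sgn zero    = 1ℤ
  sgn (suc j) = -ᶻ sgn j

  qPoch : ℕ → ℕ → Series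
  qPoch a zero    = 𝟙
  qPoch a (suc l) = 1-X^ a ⊛ qPoch (suc a) l

  plusPoch : ℕ → Series
  plusPoch zero    = 𝟙
  plusPoch (suc n) = plusPoch n ⊛ 1+X^ (suc n)

  oddPoch : ℕ → Series
  oddPoch zero    = 𝟙
  oddPoch (suc n) = oddPoch n ⊛ 1-X^ (suc (n ℕ.+ n))

  thetaTerm : ℕ → Series
  thetaTerm i = const (sgn (suc i)) ⊛ X^ (suc i ℕ.* suc i)

  theta : ℕ → Series
  theta n = 𝟙 ⊕ const (+ 2) ⊛ sumBelow n thetaTerm

  1-X^-cong : ∀ {a b} → a ≡ b → 1-X^ a ≈ 1-X^ b
  1-X^-cong refl = ≈-refl

  qPoch-cong : ∀ {a b} l → a ≡ b → qPoch a l ≈ qPoch b l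
  qPoch-cong l refl = ≈-refl

  qPoch-++ : ∀ a l k → qPoch a (l ℕ.+ k) ≈ qPoch a l ⊛ qPoch (a ℕ.+ l) k
  qPoch-++ a zero    k = ≈-sym (≈-trans (⊛-identityˡ _) (qPoch-cong k (ℕP.+-identityʳ a)))
  qPoch-++ a (suc l) k = begin
      1-X^ a ⊛ qPoch (suc a) (l ℕ.+ k)
    ≈⟨ ⊛-congˡ (qPoch-++ (suc a) l k) ⟩
      1-X^ a ⊛ (qPoch (suc a) l ⊛ qPoch (suc a ℕ.+ l) k)
    ≈⟨ ⊛-assoc (1-X^ a) _ _ ⟨
      1-X^ a ⊛ qPoch (suc a) l ⊛ qPoch (suc a ℕ.+ l) k
    ≈⟨ ⊛-congˡ (qPoch-cong k (≡.sym (ℕP.+-suc a l))) ⟩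
      1-X^ a ⊛ qPoch (suc a) l ⊛ qPoch (a ℕ.+ suc l) k
    ∎

  qPoch-snoc : ∀ a l → qPoch a (suc l) ≈ qPoch a l ⊛ 1-X^ (a ℕ.+ l)
  qPoch-snoc a l = begin
      qPoch a (suc l)                    ≡⟨ ≡.cong (qPoch a) (ℕP.+-comm 1 l) ⟩
      qPoch a (l ℕ.+ 1)                  ≈⟨ qPoch-++ a l 1 ⟩
      qPoch a l ⊛ (1-X^ (a ℕ.+ l) ⊛ 𝟙)  ≈⟨ ⊛-congˡ (⊛-identityʳ _) ⟩
      qPoch a l ⊛ 1-X^ (a ℕ.+ l)        ∎

  qPoch≈[]𝟙 : ∀ a l → qPoch (suc a) l ≈[ a ] 𝟙
  qPoch≈[]𝟙 a zero    = ≈[]-refl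
  qPoch≈[]𝟙 a (suc l) = ≈[]-trans (⊛-cong[] 1-X^≈[]𝟙 (≈[]-mono (ℕP.n≤1+n a) (qPoch≈[]𝟙 (suc a) l))) (≈⇒≈[] (⊛-identityˡ 𝟙))
    where
    1-X^≈[]𝟙 : 1-X^ (suc a) ≈[ a ] 𝟙
    1-X^≈[]𝟙 = ≈[]-trans (⊕-cong[] (≈[]-refl {𝟙}) (⊖-cong[] (X^≈[]𝟘 (suc a) a ℕP.≤-refl))) (≈⇒≈[] (λ n → ℤP.+-identityʳ (𝟙 n)))

  -- A finite form of Gauss's identity: with term j m = (-1)^j X^(j²) (X^(m+1); X)_j (X^(2j+m+1); X)_m,
  -- gaussSum n = term 0 n + 2 Σ_{1 ≤ j ≤ n} term j (n - j) is (X; X)_n (X; X²)_n exactly, and theta n modulo X^(n+1).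
  term : ℕ → ℕ → Series
  term j m = const (sgn j) ⊛ X^ (j ℕ.* j) ⊛ (qPoch (suc m) j ⊛ qPoch (j ℕ.+ j ℕ.+ suc m) m)

  factor : ℕ → Series
  factor n = 1-X^ (suc n) ⊛ 1-X^ (suc (n ℕ.+ n))

  -- term j (m+1) - factor (j+m) ⊛ term j m = δ j (m+1) - δ (j+1) m, so the sum over j telescopes.
  δ : ℕ → ℕ → Series
  δ j m = const (sgn j) ⊛ X^ (j ℕ.* j ℕ.+ m) ⊛ (qPoch (suc m) j ⊛ qPoch (j ℕ.+ j ℕ.+ m) m)

  module TermStep (i m : ℕ) where

    j n : ℕ
    j = suc i
    n = j ℕ.+ m

    σ p A B C xa xb : Series
    σ  = const (sgn j)
    p  = X^ (j ℕ.* j)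
    A  = qPoch (suc (suc m)) i
    B  = qPoch (j ℕ.+ j ℕ.+ suc m) m
    C  = qPoch (j ℕ.+ j ℕ.+ suc (suc m)) m
    xa = X^ (suc m)
    xb = X^ (j ℕ.+ j ℕ.+ suc m)

    A-last : suc (suc m) ℕ.+ i ≡ suc (suc i ℕ.+ m)
    A-last = ℕ-solve (i ∷ m ∷ [])
    B-last : suc ((suc i ℕ.+ m) ℕ.+ (suc i ℕ.+ m)) ≡ suc i ℕ.+ suc i ℕ.+ suc m ℕ.+ m
    B-last = ℕ-solve (i ∷ m ∷ [])
    B-shift : suc (suc i ℕ.+ suc i ℕ.+ suc m) ≡ suc i ℕ.+ suc i ℕ.+ suc (suc m)
    B-shift = ℕ-solve (i ∷ m ∷ [])
    C-last : suc i ℕ.+ suc i ℕ.+ suc (suc m) ℕ.+ m ≡ suc m ℕ.+ (suc i ℕ.+ suc i ℕ.+ suc m)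
    C-last = ℕ-solve (i ∷ m ∷ [])
    δ-exponent : suc (suc i) ℕ.* suc (suc i) ℕ.+ m ≡ suc i ℕ.* suc i ℕ.+ (suc i ℕ.+ suc i ℕ.+ suc m)
    δ-exponent = ℕ-solve (i ∷ m ∷ [])
    δ-start : suc (suc i) ℕ.+ suc (suc i) ℕ.+ m ≡ suc i ℕ.+ suc i ℕ.+ suc (suc m)
    δ-start = ℕ-solve (i ∷ m ∷ [])

    A-snoc : qPoch (suc (suc m)) j ≈ A ⊛ 1-X^ (suc n)
    A-snoc = ≈-trans (qPoch-snoc (suc (suc m)) i) (⊛-congˡ (1-X^-cong A-last))

    B-snoc : B ⊛ 1-X^ (suc (n ℕ.+ n)) ≈ 1-X^ (j ℕ.+ j ℕ.+ suc m) ⊛ C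
    B-snoc = ≈-trans (⊛-congˡ (1-X^-cong B-last)) (≈-trans (≈-sym (qPoch-snoc (j ℕ.+ j ℕ.+ suc m) m))
               (⊛-congˡ (qPoch-cong m B-shift)))

    C-snoc : qPoch (j ℕ.+ j ℕ.+ suc (suc m)) (suc m) ≈ C ⊛ (𝟙 ⊕ ⊖ (xa ⊛ xb))
    C-snoc = ≈-trans (qPoch-snoc _ m) (⊛-congˡ (⊕-congˡ {𝟙} (⊖-cong (≈-trans (X^-cong C-last) (≈-sym (X^-+ (suc m) _))))))

    factor⊛term : factor n ⊛ term j m ≈ 1-X^ (suc n) ⊛ (σ ⊛ p ⊛ ((1-X^ (suc m) ⊛ A) ⊛ ((𝟙 ⊕ ⊖ xb) ⊛ C)))
    factor⊛term = begin
        (1-X^ (suc n) ⊛ 1-X^ (suc (n ℕ.+ n))) ⊛ (σ ⊛ p ⊛ ((1-X^ (suc m) ⊛ A) ⊛ B))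
      ≈⟨ solve 7 (λ F W σ p a A B → (F :* W) :* (σ :* p :* ((a :* A) :* B)) := F :* (σ :* p :* ((a :* A) :* (B :* W))))
           ≈-refl (1-X^ (suc n)) (1-X^ (suc (n ℕ.+ n))) σ p (1-X^ (suc m)) A B ⟩
        1-X^ (suc n) ⊛ (σ ⊛ p ⊛ ((1-X^ (suc m) ⊛ A) ⊛ (B ⊛ 1-X^ (suc (n ℕ.+ n)))))
      ≈⟨ ⊛-congˡ (⊛-congˡ (⊛-congˡ B-snoc)) ⟩
        1-X^ (suc n) ⊛ (σ ⊛ p ⊛ ((1-X^ (suc m) ⊛ A) ⊛ ((𝟙 ⊕ ⊖ xb) ⊛ C)))
      ∎

    δ-suc-m : δ j (suc m) ≈ σ ⊛ (p ⊛ xa) ⊛ ((A ⊛ 1-X^ (suc n)) ⊛ ((𝟙 ⊕ ⊖ xb) ⊛ C))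
    δ-suc-m = ⊛-cong (⊛-congˡ (≈-sym (X^-+ (j ℕ.* j) (suc m)))) (⊛-cong A-snoc (⊛-congˡ (qPoch-cong m B-shift)))

    δ-suc-j : δ (suc j) m ≈ ⊖ σ ⊛ (p ⊛ xb) ⊛ ((1-X^ (suc m) ⊛ (A ⊛ 1-X^ (suc n))) ⊛ C)
    δ-suc-j = ⊛-cong (⊛-cong (const-neg (sgn j)) (≈-trans (X^-cong δ-exponent) (≈-sym (X^-+ (j ℕ.* j) _))))
                (⊛-cong (⊛-congˡ A-snoc) (qPoch-cong m δ-start))

    term-step : term j (suc m) ⊕ ⊖ (factor n ⊛ term j m) ≈ δ j (suc m) ⊕ ⊖ δ (suc j) m
    term-step = begin
        term j (suc m) ⊕ ⊖ (factor n ⊛ term j m)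
      ≈⟨ ⊕-cong (⊛-congˡ (⊛-cong A-snoc C-snoc)) (⊖-cong factor⊛term) ⟩
        σ ⊛ p ⊛ ((A ⊛ 1-X^ (suc n)) ⊛ (C ⊛ (𝟙 ⊕ ⊖ (xa ⊛ xb)))) ⊕ ⊖ (1-X^ (suc n) ⊛ (σ ⊛ p ⊛ ((1-X^ (suc m) ⊛ A) ⊛ ((𝟙 ⊕ ⊖ xb) ⊛ C))))
      ≈⟨ solve 7 (λ σ p A C f a b →
            σ :* p :* ((A :* (con 1ℤ :- f)) :* (C :* (con 1ℤ :- (a :* b)))) :- ((con 1ℤ :- f) :* (σ :* p :* (((con 1ℤ :- a) :* A) :* ((con 1ℤ :- b) :* C))))
            := σ :* (p :* a) :* ((A :* (con 1ℤ :- f)) :* ((con 1ℤ :- b) :* C)) :- (:- σ :* (p :* b) :* (((con 1ℤ :- a) :* (A :* (con 1ℤ :- f))) :* C)))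
           ≈-refl σ p A C (X^ (suc n)) xa xb ⟩
        σ ⊛ (p ⊛ xa) ⊛ ((A ⊛ 1-X^ (suc n)) ⊛ ((𝟙 ⊕ ⊖ xb) ⊛ C)) ⊕ ⊖ (⊖ σ ⊛ (p ⊛ xb) ⊛ ((1-X^ (suc m) ⊛ (A ⊛ 1-X^ (suc n))) ⊛ C))
      ≈⟨ ⊕-cong (≈-sym δ-suc-m) (⊖-cong (≈-sym δ-suc-j)) ⟩
        δ j (suc m) ⊕ ⊖ δ (suc j) m
      ∎

  open TermStep using (term-step)

  term₀-step : ∀ n → term 0 (suc n) ⊕ ⊖ (factor n ⊛ term 0 n) ≈ ⊖ (const (+ 2) ⊛ δ 1 n)
  term₀-step n = begin
      𝟙 ⊛ 𝟙 ⊛ (𝟙 ⊛ qPoch (suc (suc n)) (suc n)) ⊕ ⊖ ((1-X^ (suc n) ⊛ W) ⊛ (𝟙 ⊛ 𝟙 ⊛ (𝟙 ⊛ Q)))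
    ≈⟨ ⊕-congʳ (⊛-congˡ (⊛-congˡ R-snoc)) ⟩
      𝟙 ⊛ 𝟙 ⊛ (𝟙 ⊛ (R ⊛ (𝟙 ⊕ ⊖ (x ⊛ x)))) ⊕ ⊖ ((1-X^ (suc n) ⊛ W) ⊛ (𝟙 ⊛ 𝟙 ⊛ (𝟙 ⊛ Q)))
    ≈⟨ solve 4 (λ R f W Q → con 1ℤ :* con 1ℤ :* (con 1ℤ :* (R :* (con 1ℤ :- f :* f))) :- (((con 1ℤ :- f) :* W) :* (con 1ℤ :* con 1ℤ :* (con 1ℤ :* Q)))
                  := R :* (con 1ℤ :- f :* f) :- (con 1ℤ :- f) :* (Q :* W)) ≈-refl R x W Q ⟩
      R ⊛ (𝟙 ⊕ ⊖ (x ⊛ x)) ⊕ ⊖ (1-X^ (suc n) ⊛ (Q ⊛ W))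
    ≈⟨ ⊕-congˡ {R ⊛ (𝟙 ⊕ ⊖ (x ⊛ x))} (⊖-cong (⊛-congˡ {1-X^ (suc n)} (≈-sym (qPoch-snoc (suc n) n)))) ⟩
      R ⊛ (𝟙 ⊕ ⊖ (x ⊛ x)) ⊕ ⊖ (1-X^ (suc n) ⊛ (1-X^ (suc n) ⊛ R))
    ≈⟨ solve 2 (λ R f → R :* (con 1ℤ :- f :* f) :- (con 1ℤ :- f) :* ((con 1ℤ :- f) :* R)
                  := :- (con (+ 2) :* (con (-ᶻ 1ℤ) :* f :* (((con 1ℤ :- f) :* con 1ℤ) :* R)))) ≈-refl R x ⟩
      ⊖ (const (+ 2) ⊛ δ 1 n)
    ∎
    where
    R W Q x : Series
    R = qPoch (suc (suc n)) n
    W = 1-X^ (suc (n ℕ.+ n))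
    Q = qPoch (suc n) n
    x = X^ (suc n)
    R-snoc : qPoch (suc (suc n)) (suc n) ≈ R ⊛ (𝟙 ⊕ ⊖ (x ⊛ x))
    R-snoc = ≈-trans (qPoch-snoc (suc (suc n)) n) (⊛-congˡ (⊕-congˡ {𝟙} (⊖-cong
               (≈-trans (X^-cong (≡.cong suc (≡.sym (ℕP.+-suc n n)))) (≈-sym (X^-+ (suc n) (suc n)))))))

  telescope : ∀ n k → k ≤ n →
    sumBelow k (λ i → term (suc i) (n ∸ i)) ⊕ ⊖ (factor n ⊛ sumBelow k (λ i → term (suc i) (n ∸ suc i)))
      ≈ δ 1 n ⊕ ⊖ δ (suc k) (n ∸ k)
  telescope n zero    _    = ≈-trans (λ i → ≡.cong (λ v → 0ℤ ℤ.+ -ᶻ v) (⊛-zeroʳ (factor n) i)) (≈-sym (⊖-inverseʳ (δ 1 n)))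
  telescope n (suc k) k<n = begin
      (S₁ ⊕ term (suc k) (n ∸ k)) ⊕ ⊖ (factor n ⊛ (S₀ ⊕ term (suc k) m))
    ≈⟨ solve 5 (λ a b c e f → (a :+ b) :- c :* (e :+ f) := (a :- c :* e) :+ (b :- c :* f)) ≈-refl
         S₁ (term (suc k) (n ∸ k)) (factor n) S₀ (term (suc k) m) ⟩
      (S₁ ⊕ ⊖ (factor n ⊛ S₀)) ⊕ (term (suc k) (n ∸ k) ⊕ ⊖ (factor n ⊛ term (suc k) m))
    ≈⟨ ⊕-cong (telescope n k (ℕP.<⇒≤ k<n)) new-terms ⟩
      (δ 1 n ⊕ ⊖ δ (suc k) (n ∸ k)) ⊕ (δ (suc k) (n ∸ k) ⊕ ⊖ δ (suc (suc k)) m)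
    ≈⟨ solve 3 (λ a b c → (a :- b) :+ (b :- c) := a :- c) ≈-refl (δ 1 n) (δ (suc k) (n ∸ k)) (δ (suc (suc k)) m) ⟩
      δ 1 n ⊕ ⊖ δ (suc (suc k)) m
    ∎
    where
    m : ℕ
    m = n ∸ suc k
    S₁ S₀ : Series
    S₁ = sumBelow k (λ i → term (suc i) (n ∸ i))
    S₀ = sumBelow k (λ i → term (suc i) (n ∸ suc i))
    n∸k≡1+m : n ∸ k ≡ suc m
    n∸k≡1+m = ℕP.+-∸-assoc 1 k<n
    new-terms : term (suc k) (n ∸ k) ⊕ ⊖ (factor n ⊛ term (suc k) m) ≈ δ (suc k) (n ∸ k) ⊕ ⊖ δ (suc (suc k)) m
    new-terms = begin
        term (suc k) (n ∸ k) ⊕ ⊖ (factor n ⊛ term (suc k) m)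
      ≈⟨ ⊕-cong (≡⇒≈ (≡.cong (term (suc k)) n∸k≡1+m)) (⊖-cong (⊛-congʳ (≡⇒≈ (≡.cong factor (≡.sym (ℕP.m+[n∸m]≡n k<n)))))) ⟩
        term (suc k) (suc m) ⊕ ⊖ (factor (suc k ℕ.+ m) ⊛ term (suc k) m)
      ≈⟨ term-step k m ⟩
        δ (suc k) (suc m) ⊕ ⊖ δ (suc (suc k)) m
      ≈⟨ ⊕-congʳ (≡⇒≈ (≡.cong (δ (suc k)) (≡.sym n∸k≡1+m))) ⟩
        δ (suc k) (n ∸ k) ⊕ ⊖ δ (suc (suc k)) m
      ∎

  gaussSum : ℕ → Series
  gaussSum n = term 0 n ⊕ const (+ 2) ⊛ sumBelow n (λ i → term (suc i) (n ∸ suc i))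

  gaussSum-suc : ∀ n → gaussSum (suc n) ≈ factor n ⊛ gaussSum n
  gaussSum-suc n = begin
      term 0 (suc n) ⊕ const (+ 2) ⊛ (S₁ ⊕ term (suc n) (n ∸ n))
    ≈⟨ ⊕-congˡ {term 0 (suc n)} (⊛-congˡ {const (+ 2)} (⊕-congˡ {S₁} (≡⇒≈ (≡.cong (term (suc n)) (ℕP.n∸n≡0 n))))) ⟩
      term 0 (suc n) ⊕ const (+ 2) ⊛ (S₁ ⊕ term (suc n) 0)
    ≈⟨ solve 6 (λ a b c e f g → a :+ con (+ 2) :* (e :+ g) := (a :- c :* b) :+ con (+ 2) :* (e :- c :* f) :+ con (+ 2) :* g :+ c :* (b :+ con (+ 2) :* f))
         ≈-refl (term 0 (suc n)) (term 0 n) (factor n) S₁ S₀ (term (suc n) 0) ⟩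
      (term 0 (suc n) ⊕ ⊖ (factor n ⊛ term 0 n)) ⊕ const (+ 2) ⊛ (S₁ ⊕ ⊖ (factor n ⊛ S₀)) ⊕ const (+ 2) ⊛ term (suc n) 0 ⊕ factor n ⊛ gaussSum n
    ≈⟨ ⊕-congʳ (⊕-cong (⊕-cong (term₀-step n) (⊛-congˡ (telescope n n ℕP.≤-refl))) (⊛-congˡ last-term)) ⟩
      ⊖ (const (+ 2) ⊛ δ 1 n) ⊕ const (+ 2) ⊛ (δ 1 n ⊕ ⊖ δ (suc n) (n ∸ n)) ⊕ const (+ 2) ⊛ δ (suc n) 0 ⊕ factor n ⊛ gaussSum n
    ≈⟨ ⊕-congʳ (⊕-congʳ (⊕-congˡ {⊖ (const (+ 2) ⊛ δ 1 n)} (⊛-congˡ {const (+ 2)} (⊕-congˡ {δ 1 n} (⊖-cong (≡⇒≈ (≡.cong (δ (suc n)) (ℕP.n∸n≡0 n)))))))) ⟩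
      ⊖ (const (+ 2) ⊛ δ 1 n) ⊕ const (+ 2) ⊛ (δ 1 n ⊕ ⊖ δ (suc n) 0) ⊕ const (+ 2) ⊛ δ (suc n) 0 ⊕ factor n ⊛ gaussSum n
    ≈⟨ solve 3 (λ a b z → :- (con (+ 2) :* a) :+ con (+ 2) :* (a :- b) :+ con (+ 2) :* b :+ z := z) ≈-refl (δ 1 n) (δ (suc n) 0) (factor n ⊛ gaussSum n) ⟩
      factor n ⊛ gaussSum n
    ∎
    where
    S₁ S₀ : Series
    S₁ = sumBelow n (λ i → term (suc i) (n ∸ i))
    S₀ = sumBelow n (λ i → term (suc i) (n ∸ suc i))
    last-term : term (suc n) 0 ≈ δ (suc n) 0
    last-term = ⊛-congʳ (⊛-congˡ (X^-cong (≡.sym (ℕP.+-identityʳ (suc n ℕ.* suc n)))))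

  gaussSum-product : ∀ n → gaussSum n ≈ qPoch 1 n ⊛ oddPoch n
  gaussSum-product zero    = ≈-trans (⊕-congˡ {term 0 0} (⊛-zeroʳ (const (+ 2)))) (≈-trans (λ i → ℤP.+-identityʳ (term 0 0 i))
    (solve 0 (con 1ℤ :* con 1ℤ :* (con 1ℤ :* con 1ℤ) := con 1ℤ :* con 1ℤ) ≈-refl))
  gaussSum-product (suc n) = begin
      gaussSum (suc n)
    ≈⟨ gaussSum-suc n ⟩
      1-X^ (suc n) ⊛ 1-X^ (suc (n ℕ.+ n)) ⊛ gaussSum n
    ≈⟨ ⊛-congˡ (gaussSum-product n) ⟩
      1-X^ (suc n) ⊛ 1-X^ (suc (n ℕ.+ n)) ⊛ (qPoch 1 n ⊛ oddPoch n)
    ≈⟨ solve 4 (λ a b c e → a :* b :* (c :* e) := (c :* a) :* (e :* b)) ≈-refl (1-X^ (suc n)) (1-X^ (suc (n ℕ.+ n))) (qPoch 1 n) (oddPoch n) ⟩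
      (qPoch 1 n ⊛ 1-X^ (suc n)) ⊛ oddPoch (suc n)
    ≈⟨ ⊛-congʳ (≈-sym (qPoch-snoc 1 n)) ⟩
      qPoch 1 (suc n) ⊛ oddPoch (suc n)
    ∎

  -- (-X; X)_n (X; X)_n (X; X²)_n = (X; X)_{2n}, since (1 + X^k)(1 - X^k) = 1 - X^{2k}.
  plusPoch-product : ∀ n → plusPoch n ⊛ (qPoch 1 n ⊛ oddPoch n) ≈ qPoch 1 (n ℕ.+ n)
  plusPoch-product zero    = solve 0 (con 1ℤ :* (con 1ℤ :* con 1ℤ) := con 1ℤ) ≈-refl
  plusPoch-product (suc n) = begin
      plusPoch n ⊛ 1+X^ (suc n) ⊛ (qPoch 1 (suc n) ⊛ oddPoch (suc n))
    ≈⟨ ⊛-congˡ (⊛-congʳ (qPoch-snoc 1 n)) ⟩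
      plusPoch n ⊛ 1+X^ (suc n) ⊛ ((qPoch 1 n ⊛ 1-X^ (suc n)) ⊛ (oddPoch n ⊛ 1-X^ (suc (n ℕ.+ n))))
    ≈⟨ solve 5 (λ P f C D w → P :* (con 1ℤ :+ f) :* ((C :* (con 1ℤ :- f)) :* (D :* w))
                  := (P :* (C :* D)) :* w :* (con 1ℤ :- f :* f)) ≈-refl (plusPoch n) (X^ (suc n)) (qPoch 1 n) (oddPoch n) (1-X^ (suc (n ℕ.+ n))) ⟩
      (plusPoch n ⊛ (qPoch 1 n ⊛ oddPoch n)) ⊛ 1-X^ (suc (n ℕ.+ n)) ⊛ (𝟙 ⊕ ⊖ (X^ (suc n) ⊛ X^ (suc n)))
    ≈⟨ ⊛-cong (⊛-congʳ (plusPoch-product n)) (⊕-congˡ {𝟙} (⊖-cong (X^-+ (suc n) (suc n)))) ⟩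
      qPoch 1 (n ℕ.+ n) ⊛ 1-X^ (suc (n ℕ.+ n)) ⊛ 1-X^ (suc n ℕ.+ suc n)
    ≈⟨ ⊛-cong (≈-sym (qPoch-snoc 1 (n ℕ.+ n))) (1-X^-cong (≡.cong suc (ℕP.+-suc n n))) ⟩
      qPoch 1 (suc (n ℕ.+ n)) ⊛ 1-X^ (suc (suc (n ℕ.+ n)))
    ≈⟨ qPoch-snoc 1 (suc (n ℕ.+ n)) ⟨
      qPoch 1 (suc (suc (n ℕ.+ n)))
    ≡⟨ ≡.cong (qPoch 1) (≡.cong suc (≡.sym (ℕP.+-suc n n))) ⟩
      qPoch 1 (suc n ℕ.+ suc n)
    ∎

  gaussSum≈[]theta : ∀ n → gaussSum n ≈[ n ] theta n
  gaussSum≈[]theta n = ⊕-cong[] term₀≈[]𝟙 (⊛-cong[] (≈[]-refl {const (+ 2)}) (sumBelow-cong[] n term≈[]leading))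
    where
    term₀≈[]𝟙 : term 0 n ≈[ n ] 𝟙
    term₀≈[]𝟙 = ≈[]-trans (≈⇒≈[] (solve 1 (λ a → con 1ℤ :* con 1ℤ :* (con 1ℤ :* a) := a) ≈-refl (qPoch (suc n) n))) (qPoch≈[]𝟙 n n)
    term≈[]leading : ∀ i → i < n → term (suc i) (n ∸ suc i) ≈[ n ] const (sgn (suc i)) ⊛ X^ (suc i ℕ.* suc i)
    term≈[]leading i i<n = ≈[]-trans (≈⇒≈[] (⊛-assoc (const (sgn j)) (X^ (j ℕ.* j)) _))
      (⊛-cong[] (≈[]-refl {const (sgn j)})
        (≈[]-trans (≈[]-mono n≤j²+m (X^⊛-cong[] (j ℕ.* j) qPochs≈[]𝟙)) (≈⇒≈[] (⊛-identityʳ (X^ (j ℕ.* j))))))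
      where
      j m : ℕ
      j = suc i
      m = n ∸ j
      n≤j²+m : n ≤ j ℕ.* j ℕ.+ m
      n≤j²+m = ≡.subst (_≤ j ℕ.* j ℕ.+ m) (ℕP.m+[n∸m]≡n i<n) (ℕP.+-monoˡ-≤ m (ℕP.m≤m*n j j))
      qPochs≈[]𝟙 : qPoch (suc m) j ⊛ qPoch (j ℕ.+ j ℕ.+ suc m) m ≈[ m ] 𝟙
      qPochs≈[]𝟙 = ≈[]-trans (⊛-cong[] (qPoch≈[]𝟙 m j)
        (≈[]-trans (≈⇒≈[] (qPoch-cong m (ℕP.+-suc (j ℕ.+ j) m))) (≈[]-mono (ℕP.m≤n+m m (j ℕ.+ j)) (qPoch≈[]𝟙 (j ℕ.+ j ℕ.+ m) m))))
        (≈⇒≈[] (⊛-identityˡ 𝟙))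

  gauss-identity[] : ∀ n → plusPoch n ⊛ theta n ≈[ n ] qPoch 1 n
  gauss-identity[] n =
    ≈[]-trans (⊛-cong[] (≈[]-refl {plusPoch n}) (≈[]-sym (gaussSum≈[]theta n)))
    (≈[]-trans (≈⇒≈[] (≈-trans (⊛-congˡ (gaussSum-product n)) (≈-trans (plusPoch-product n) (qPoch-++ 1 n n))))
    (≈[]-trans (⊛-cong[] (≈[]-refl {qPoch 1 n}) (qPoch≈[]𝟙 n n)) (≈⇒≈[] (⊛-identityʳ (qPoch 1 n)))))

module RestrictedPartitions where

  open PowerSeries using (Series; 𝟙; sumBelow; shift; shift-above; shift-below)
  open import Data.Nat as ℕ using (ℕ; zero; suc; _≤_; _<_; z≤n; s≤s; _∸_; _+_; _%_; _<?_; _≤?_)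
  import Data.Nat.Properties as ℕP
  import Data.Nat.DivMod as DivMod
  open import Data.Integer as ℤ using (ℤ; -1ℤ) renaming (_+_ to _+ᶻ_; -_ to -ᶻ_)
  import Data.Integer.Properties as ℤP
  open import Data.Integer.Properties using (+-0-isCommutativeMonoid)
  open import Data.List using (List; []; _∷_; _++_; [_]; map; _∷ʳ_; length; initLast; _∷ʳ′_)
  import Data.List.Properties as List
  open import Data.List.Membership.Propositional using (_∈_)
  open import Data.List.Membership.Propositional.Properties using (∈-++⁺ˡ; ∈-++⁺ʳ; ∈-++⁻; ∈-map⁺; ∈-map⁻)
  open import Data.List.Membership.Propositional.Properties.WithK using (unique∧set⇒bag)
  open import Data.List.Relation.Binary.BagAndSetEquality using (∼bag⇒↭)
  open import Data.List.Relation.Binary.Permutation.Propositional using (↭⇒↭ₛ)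
  import Data.List.Relation.Binary.Permutation.Setoid.Properties as ↭
  open import Data.List.Relation.Unary.Any using (here)
  open import Data.List.Relation.Unary.All as All using (All; []; _∷_)
  import Data.List.Relation.Unary.All.Properties as All
  open import Data.List.Relation.Unary.AllPairs as AllPairs using (AllPairs; []; _∷_)
  import Data.List.Relation.Unary.AllPairs.Properties as AllPairs
  open import Data.List.Relation.Unary.Linked using (Linked; []; [-]; _∷_)
  import Data.List.Relation.Unary.Linked.Properties as Linked
  open import Data.List.Relation.Unary.Unique.Propositional using (Unique)
  import Data.List.Relation.Unary.Unique.Propositional.Properties as Unique
  open import Data.Product using (_×_; _,_; proj₁; proj₂; ∃-syntax)
  open import Data.Sum using (_⊎_; inj₁; inj₂)
  open import Function.Bundles using (_⇔_; mk⇔; Equivalence)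
  open import Function.Properties.Equivalence using () renaming (trans to ⇔-trans; sym to ⇔-sym)
  open import Relation.Binary.PropositionalEquality hiding ([_])
  open import Relation.Nullary using (¬_; yes; no; contradiction)

  signedCount-++ : ∀ xs ys → signedCount (xs ++ ys) ≡ signedCount xs +ᶻ signedCount ys
  signedCount-++ []       ys = sym (ℤP.+-identityˡ (signedCount ys))
  signedCount-++ (π ∷ xs) ys = trans (cong (-1ℤ ℤ.^ ν π +ᶻ_) (signedCount-++ xs ys)) (sym (ℤP.+-assoc (-1ℤ ℤ.^ ν π) _ _))

  signedCount-∷ʳ : ∀ s xs → signedCount (map (_∷ʳ s) xs) ≡ -ᶻ signedCount xs
  signedCount-∷ʳ s []       = refl
  signedCount-∷ʳ s (π ∷ xs) = trans (cong₂ _+ᶻ_ sign-∷ʳ (signedCount-∷ʳ s xs)) (sym (ℤP.neg-distrib-+ (-1ℤ ℤ.^ ν π) _))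
    where
    sign-∷ʳ : -1ℤ ℤ.^ ν (π ∷ʳ s) ≡ -ᶻ (-1ℤ ℤ.^ ν π)
    sign-∷ʳ = begin
      -1ℤ ℤ.^ length (π ++ [ s ])     ≡⟨ cong (-1ℤ ℤ.^_) (trans (List.length-++ π) (ℕP.+-comm (length π) 1)) ⟩
      -1ℤ ℤ.* (-1ℤ ℤ.^ length π)      ≡⟨ ℤP.-1*i≡-i _ ⟩
      -ᶻ (-1ℤ ℤ.^ length π)           ∎ where open ≡-Reasoning

  -- Two duplicate-free lists with the same elements are permutations of each other.
  signedCount-≡ : ∀ {xs ys} → Unique xs → Unique ys → (∀ {π} → π ∈ xs ⇔ π ∈ ys) → signedCount xs ≡ signedCount ys
  signedCount-≡ {xs} {ys} !xs !ys xs⇔ys =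
    ↭.foldr-commMonoid (setoid ℤ) +-0-isCommutativeMonoid (↭⇒↭ₛ (map⁺ (λ π → -1ℤ ℤ.^ ν π) (∼bag⇒↭ (unique∧set⇒bag !xs !ys xs⇔ys))))
    where open import Data.List.Relation.Binary.Permutation.Propositional.Properties using (map⁺)

  parity : ∀ n → n % 2 ≡ 0 ⊎ n % 2 ≡ 1
  parity n with n % 2 | DivMod.m%n<n n 2
  ... | 0 | _ = inj₁ refl
  ... | 1 | _ = inj₂ refl
  ... | suc (suc _) | s≤s (s≤s ())

  %2-suc-suc : ∀ n → suc (suc n) % 2 ≡ n % 2
  %2-suc-suc n = trans (cong (_% 2) (ℕP.+-comm 2 n)) (DivMod.[m+n]%n≡m%n n 2)

  -- b may follow a in a non-increasing list whose even entries are distinct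
  _≽_ : ℕ → ℕ → Set
  a ≽ b = b ≤ a × (a ≡ b → a % 2 ≡ 1)

  ≽-trans : ∀ {a b c} → a ≽ b → b ≽ c → a ≽ c
  ≽-trans (b≤a , a≡b⇒odd) (c≤b , _) =
    ℕP.≤-trans c≤b b≤a , λ { refl → a≡b⇒odd (ℕP.≤-antisym c≤b b≤a) }

  Restricted : ℕ → List ℕ → Set
  Restricted s π = All (s ≤_) π × AllPairs _≽_ π

  -- the least part that may precede a part s
  next : ℕ → ℕ
  next s = s + (1 ∸ s % 2)

  s≤next : ∀ s → s ≤ next s
  s≤next s = ℕP.m≤m+n s _

  next≤⇔≽ : ∀ {s a} → next s ≤ a ⇔ a ≽ s
  next≤⇔≽ {s} {a} = mk⇔ to from
    where
    to : next s ≤ a → a ≽ s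
    to next≤a = ℕP.≤-trans (s≤next s) next≤a , λ { refl → odd next≤a }
      where
      odd : next a ≤ a → a % 2 ≡ 1
      odd le with parity a
      ... | inj₂ a-odd  = a-odd
      ... | inj₁ a-even rewrite a-even = contradiction (ℕP.≤-trans (ℕP.≤-reflexive (ℕP.+-comm 1 a)) le) (ℕP.n≮n a)
    from : a ≽ s → next s ≤ a
    from (s≤a , a≡s⇒odd) with parity s
    ... | inj₂ s-odd  rewrite s-odd = ℕP.≤-trans (ℕP.≤-reflexive (ℕP.+-identityʳ s)) s≤a
    ... | inj₁ s-even rewrite s-even = ℕP.≤-trans (ℕP.≤-reflexive (ℕP.+-comm s 1))
                                        (ℕP.≤∧≢⇒< s≤a (λ { refl → contradiction (trans (sym s-even) (a≡s⇒odd refl)) λ () }))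

  AllPairs-∷ʳ⁺ : ∀ {R : ℕ → ℕ → Set} {xs x} → AllPairs R xs → All (λ y → R y x) xs → AllPairs R (xs ∷ʳ x)
  AllPairs-∷ʳ⁺ p q = AllPairs.++⁺ p ([] ∷ []) (All.map (_∷ []) q)

  AllPairs-∷ʳ⁻ : ∀ {R : ℕ → ℕ → Set} {xs x} → AllPairs R (xs ∷ʳ x) → AllPairs R xs × All (λ y → R y x) xs
  AllPairs-∷ʳ⁻ {xs = []}     _       = [] , []
  AllPairs-∷ʳ⁻ {xs = y ∷ xs} (r ∷ p) with AllPairs-∷ʳ⁻ {xs = xs} p | All.∷ʳ⁻ {xs = xs} r
  ... | p′ , q | ry , rx = (ry ∷ p′) , (rx ∷ q)

  size-∷ʳ : ∀ π s → size (π ∷ʳ s) ≡ size π + s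
  size-∷ʳ []      s = ℕP.+-identityʳ s
  size-∷ʳ (x ∷ π) s = trans (cong (x +_) (size-∷ʳ π s)) (sym (ℕP.+-assoc x (size π) s))

  restricted-∷ʳ⁺ : ∀ {s π} → Restricted (next s) π → Restricted s (π ∷ʳ s)
  restricted-∷ʳ⁺ {s} (≥next , ≽π) =
    All.∷ʳ⁺ (All.map (ℕP.≤-trans (s≤next s)) ≥next) ℕP.≤-refl , AllPairs-∷ʳ⁺ ≽π (All.map (Equivalence.to next≤⇔≽) ≥next)

  restricted-∷ʳ⁻ : ∀ {s π} → Restricted s (π ∷ʳ s) → Restricted (next s) π
  restricted-∷ʳ⁻ {π = π} (_ , ≽π) with AllPairs-∷ʳ⁻ {xs = π} ≽π
  ... | ≽π′ , ≽s = All.map (Equivalence.from next≤⇔≽) ≽s , ≽π′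

  restricted-∷ʳ-suc : ∀ {s π x} → s < x → Restricted s (π ∷ʳ x) → Restricted (suc s) (π ∷ʳ x)
  restricted-∷ʳ-suc {π = π} s<x (_ , ≽π) =
    All.∷ʳ⁺ (All.map (λ y≽x → ℕP.≤-trans s<x (proj₁ y≽x)) (proj₂ (AllPairs-∷ʳ⁻ {xs = π} ≽π))) s<x , ≽π

  onlyEmpty : ℕ → List (List ℕ)
  onlyEmpty zero    = [ [] ]
  onlyEmpty (suc _) = []

  -- Split off the smallest part: either it exceeds s, or it is s and the rest has parts ≥ next s.
  enumerate : ℕ → ℕ → ℕ → List (List ℕ)
  enumerate zero    s N = onlyEmpty N
  enumerate (suc f) s N with N <? s
  ... | yes _ = onlyEmpty N
  ... | no  _ = enumerate f (suc s) N ++ map (_∷ʳ s) (enumerate f (next s) (N ∸ s))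

  ∈-onlyEmpty : ∀ {π N} → π ∈ onlyEmpty N → π ≡ [] × N ≡ 0
  ∈-onlyEmpty {N = zero} (here refl) = refl , refl

  ∈-enumerate⁻ : ∀ f s N {π} → π ∈ enumerate f s N → Restricted s π × size π ≡ N
  ∈-enumerate⁻ zero    s N π∈ with ∈-onlyEmpty {N = N} π∈
  ... | refl , refl = ([] , []) , refl
  ∈-enumerate⁻ (suc f) s N π∈ with N <? s
  ... | yes _ with ∈-onlyEmpty {N = N} π∈
  ...   | refl , refl = ([] , []) , refl
  ∈-enumerate⁻ (suc f) s N π∈ | no N≮s with ∈-++⁻ (enumerate f (suc s) N) π∈
  ... | inj₁ π∈₁ with ∈-enumerate⁻ f (suc s) N π∈₁
  ...   | (≥s , ≽π) , size≡ = (All.map ℕP.<⇒≤ ≥s , ≽π) , size≡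
  ∈-enumerate⁻ (suc f) s N π∈ | no N≮s | inj₂ π∈₂ with ∈-map⁻ (_∷ʳ s) π∈₂
  ... | π′ , π′∈ , refl with ∈-enumerate⁻ f (next s) (N ∸ s) π′∈
  ...   | restricted , size≡ = restricted-∷ʳ⁺ restricted ,
          trans (size-∷ʳ π′ s) (trans (cong (_+ s) size≡) (ℕP.m∸n+n≡m (ℕP.≮⇒≥ N≮s)))

  -- 2N + 1 - s bounds the recursion depth of enumerate from (s, N).
  fuel : ℕ → ℕ → ℕ
  fuel s N = suc (N + N) ∸ s

  fuel-suc : ∀ {s N f} → s ≤ N → fuel s N ≤ suc f → fuel (suc s) N ≤ f
  fuel-suc {s} {N} {f} s≤N le = ℕP.≤-pred (subst (_≤ suc f) (ℕP.+-∸-assoc 1 (ℕP.≤-trans s≤N (ℕP.m≤m+n N N))) le)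

  fuel-next : ∀ {s N f} s′ → 1 ≤ s′ → s ≤ N → fuel s N ≤ suc f → fuel s′ (N ∸ s) ≤ f
  fuel-next {s} {N} {f} s′ 1≤s′ s≤N le = begin
    suc (r + r) ∸ s′          ≤⟨ ℕP.∸-monoʳ-≤ (suc (r + r)) 1≤s′ ⟩
    r + r                     ≤⟨ ℕP.+-monoʳ-≤ r (ℕP.m∸n≤m N s) ⟩
    r + N                     ≡⟨ ℕP.+-∸-comm N s≤N ⟨
    suc (N + N) ∸ suc s       ≤⟨ fuel-suc s≤N le ⟩
    f                         ∎
    where
    r : ℕ
    r = N ∸ s
    open ℕP.≤-Reasoning

  restricted-empty : ∀ {s N π} → N < s → Restricted s π → size π ≡ N → π ≡ [] × N ≡ 0
  restricted-empty {π = []}     _   _            size≡ = refl , sym size≡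
  restricted-empty {π = x ∷ xs} N<s (s≤x ∷ _ , _) refl = contradiction (ℕP.≤-trans s≤x (ℕP.m≤m+n x (size xs))) (ℕP.<⇒≱ N<s)

  ∈-enumerate⁺ : ∀ f s N {π} → 1 ≤ s → fuel s N ≤ f → Restricted s π → size π ≡ N → π ∈ enumerate f s N
  ∈-enumerate⁺ zero s N 1≤s le restricted size≡
    with restricted-empty (ℕP.≤-<-trans (ℕP.m≤m+n N N) (ℕP.m∸n≡0⇒m≤n (ℕP.n≤0⇒n≡0 le))) restricted size≡
  ... | refl , refl = here refl
  ∈-enumerate⁺ (suc f) s N 1≤s le restricted size≡ with N <? s
  ... | yes N<s with restricted-empty N<s restricted size≡
  ...   | refl , refl = here refl
  ∈-enumerate⁺ (suc f) s N {π} 1≤s le restricted size≡ | no N≮s = by-last (initLast π) restricted size≡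
    where
    s≤N : s ≤ N
    s≤N = ℕP.≮⇒≥ N≮s
    by-last : ∀ {π} → Data.List.InitLast π → Restricted s π → size π ≡ N →
              π ∈ enumerate f (suc s) N ++ map (_∷ʳ s) (enumerate f (next s) (N ∸ s))
    by-last [] _ size≡ = contradiction (subst (1 ≤_) (sym size≡) (ℕP.≤-trans 1≤s s≤N)) λ ()
    by-last (π′ ∷ʳ′ x) restricted@(≥s , _) size≡ with x ℕ.≟ s
    ... | yes refl = ∈-++⁺ʳ (enumerate f (suc s) N) (∈-map⁺ (_∷ʳ x)
          (∈-enumerate⁺ f (next x) (N ∸ x) (ℕP.≤-trans 1≤s (s≤next x)) (fuel-next (next x) (ℕP.≤-trans 1≤s (s≤next x)) s≤N le)
             (restricted-∷ʳ⁻ restricted) (trans (sym (ℕP.m+n∸n≡m (size π′) x)) (cong (_∸ x) (trans (sym (size-∷ʳ π′ x)) size≡)))))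
    ... | no x≢s = ∈-++⁺ˡ (∈-enumerate⁺ f (suc s) N (ℕP.≤-trans 1≤s (ℕP.n≤1+n s)) (fuel-suc s≤N le)
          (restricted-∷ʳ-suc s<x restricted) size≡)
      where
      s<x : s < x
      s<x = ℕP.≤∧≢⇒< (proj₂ (All.∷ʳ⁻ {xs = π′} ≥s)) (λ s≡x → x≢s (sym s≡x))

  onlyEmpty-unique : ∀ N → Unique (onlyEmpty N)
  onlyEmpty-unique zero    = [] ∷ []
  onlyEmpty-unique (suc N) = []

  ∷ʳ-injective : ∀ {s} {π π′ : List ℕ} → π ∷ʳ s ≡ π′ ∷ʳ s → π ≡ π′
  ∷ʳ-injective {π = π} {π′} = List.∷ʳ-injectiveˡ π π′

  enumerate-unique : ∀ f s N → Unique (enumerate f s N)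
  enumerate-unique zero    s N = onlyEmpty-unique N
  enumerate-unique (suc f) s N with N <? s
  ... | yes _ = onlyEmpty-unique N
  ... | no  _ = Unique.++⁺ (enumerate-unique f (suc s) N) (Unique.map⁺ ∷ʳ-injective (enumerate-unique f (next s) (N ∸ s))) disjoint
    where
    disjoint : ∀ {π} → ¬ (π ∈ enumerate f (suc s) N × π ∈ map (_∷ʳ s) (enumerate f (next s) (N ∸ s)))
    disjoint (π∈₁ , π∈₂) with ∈-map⁻ (_∷ʳ s) π∈₂
    ... | π′ , _ , refl = ℕP.n≮n s (proj₂ (All.∷ʳ⁻ {xs = π′} (proj₁ (proj₁ (∈-enumerate⁻ f (suc s) N π∈₁)))))

  restrictedPartitions : ℕ → ℕ → List (List ℕ)
  restrictedPartitions s N = enumerate (fuel s N) s N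

  G : ℕ → ℕ → ℤ
  G s N = signedCount (restrictedPartitions s N)

  signedCount-enumerate : ∀ f s N → 1 ≤ s → fuel s N ≤ f → signedCount (enumerate f s N) ≡ G s N
  signedCount-enumerate f s N 1≤s le = signedCount-≡ (enumerate-unique f s N) (enumerate-unique (fuel s N) s N) (mk⇔
    (λ π∈ → let restricted , size≡ = ∈-enumerate⁻ f s N π∈ in ∈-enumerate⁺ (fuel s N) s N 1≤s ℕP.≤-refl restricted size≡)
    (λ π∈ → let restricted , size≡ = ∈-enumerate⁻ (fuel s N) s N π∈ in ∈-enumerate⁺ f s N 1≤s le restricted size≡))

  G-below : ∀ s N → 1 ≤ s → N < s → G s N ≡ 𝟙 N
  G-below s zero    1≤s _   = sym (signedCount-enumerate 0 s 0 1≤s (ℕP.≤-reflexive (ℕP.m≤n⇒m∸n≡0 1≤s)))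
  G-below s (suc N) _   N<s = cong signedCount (enumerate-below (fuel s (suc N)))
    where
    enumerate-below : ∀ f → enumerate f s (suc N) ≡ []
    enumerate-below zero = refl
    enumerate-below (suc f) with suc N <? s
    ... | yes _   = refl
    ... | no N≮s = contradiction N<s N≮s

  G-rec : ∀ s N → 1 ≤ s → s ≤ N → G s N ≡ G (suc s) N +ᶻ -ᶻ G (next s) (N ∸ s)
  G-rec s N 1≤s s≤N = trans (sym (signedCount-enumerate (suc (N + N)) s N 1≤s (ℕP.m∸n≤m (suc (N + N)) s))) unfold
    where
    1≤next : 1 ≤ next s
    1≤next = ℕP.≤-trans 1≤s (s≤next s)
    unfold : signedCount (enumerate (suc (N + N)) s N) ≡ G (suc s) N +ᶻ -ᶻ G (next s) (N ∸ s)
    unfold with N <? s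
    ... | yes N<s = contradiction s≤N (ℕP.<⇒≱ N<s)
    ... | no  _   = trans (signedCount-++ (enumerate (N + N) (suc s) N) _) (cong₂ _+ᶻ_
          (signedCount-enumerate (N + N) (suc s) N (s≤s z≤n) (ℕP.m∸n≤m (N + N) s))
          (trans (signedCount-∷ʳ s (enumerate (N + N) (next s) (N ∸ s)))
                 (cong -ᶻ_ (signedCount-enumerate (N + N) (next s) (N ∸ s) 1≤next
                   (ℕP.≤-trans (ℕP.∸-monoʳ-≤ _ 1≤next) (ℕP.+-mono-≤ (ℕP.m∸n≤m N s) (ℕP.m∸n≤m N s)))))))

  mult-here : ∀ k xs → mult k (k ∷ xs) ≡ suc (mult k xs)
  mult-here k xs = cong length (List.filter-accept (k ℕ.≟_) {x = k} {xs = xs} refl)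

  mult-there : ∀ {k x} xs → k ≢ x → mult k (x ∷ xs) ≡ mult k xs
  mult-there {k} {x} xs k≢x = cong length (List.filter-reject (k ℕ.≟_) {x = x} {xs = xs} k≢x)

  mult-∉ : ∀ {k} xs → All (k ≢_) xs → mult k xs ≡ 0
  mult-∉ []       []           = refl
  mult-∉ (x ∷ xs) (k≢x ∷ k∉xs) = trans (mult-there xs k≢x) (mult-∉ xs k∉xs)

  mult-≤-∷ : ∀ k x xs → mult k xs ≤ mult k (x ∷ xs)
  mult-≤-∷ k x xs with k ℕ.≟ x
  ... | yes refl = ℕP.≤-trans (ℕP.n≤1+n _) (ℕP.≤-reflexive (sym (mult-here k xs)))
  ... | no  k≢x  = ℕP.≤-reflexive (sym (mult-there xs k≢x))

  even≢odd : ∀ {a} → a % 2 ≡ 0 → a % 2 ≢ 1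
  even≢odd a-even a-odd = contradiction (trans (sym a-even) a-odd) λ ()

  mult-even≤1 : ∀ {k} π → AllPairs _≽_ π → k % 2 ≡ 0 → mult k π ≤ 1
  mult-even≤1         []       _           _      = z≤n
  mult-even≤1 {k} (x ∷ xs) (x≽xs ∷ ≽xs) k-even with k ℕ.≟ x
  ... | yes refl = ℕP.≤-reflexive (trans (mult-here k xs) (cong suc (mult-∉ xs (All.map (λ k≽y k≡y → even≢odd {k} k-even (proj₂ k≽y k≡y)) x≽xs))))
  ... | no  k≢x  = subst (_≤ 1) (sym (mult-there xs k≢x)) (mult-even≤1 xs ≽xs k-even)

  linked-≽ : ∀ π → Linked (λ a b → b ≤ a) π → (∀ k → k % 2 ≡ 0 → mult k π ≤ 1) → Linked _≽_ π
  linked-≽ []           _             _          = []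
  linked-≽ (x ∷ [])     _             _          = [-]
  linked-≽ (x ∷ y ∷ xs) (y≤x ∷ ≥y∷xs) evenMult≤1 =
    (y≤x , repeated-odd) ∷ linked-≽ (y ∷ xs) ≥y∷xs (λ k k-even → ℕP.≤-trans (mult-≤-∷ k x (y ∷ xs)) (evenMult≤1 k k-even))
    where
    repeated-odd : x ≡ y → x % 2 ≡ 1
    repeated-odd refl with parity x
    ... | inj₂ x-odd  = x-odd
    ... | inj₁ x-even = contradiction (evenMult≤1 x x-even)
                          (subst (λ m → ¬ m ≤ 1) (sym (trans (mult-here x (x ∷ xs)) (cong suc (mult-here x xs)))) λ { (s≤s ()) })

  3+4*_ : ℕ → ℕ
  3+4* t = 3 + 4 ℕ.* t

  3+4*-injective : ∀ {a b} → 3+4* a ≡ 3+4* b → a ≡ b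
  3+4*-injective {a} {b} eq = ℕP.*-cancelˡ-≡ a b 4 (ℕP.+-cancelˡ-≡ 3 (4 ℕ.* a) (4 ℕ.* b) eq)

  %4≡3⇒≡3+4* : ∀ s → s % 4 ≡ 3 → s ≡ 3+4* (s ℕ./ 4)
  %4≡3⇒≡3+4* s s≡3 = trans (DivMod.m≡m%n+[m/n]*n s 4) (cong₂ _+_ s≡3 (ℕP.*-comm (s ℕ./ 4) 4))

  3+4*-%4 : ∀ t → (3+4* t) % 4 ≡ 3
  3+4*-%4 t = trans (cong (λ m → (3 + m) % 4) (ℕP.*-comm 4 t)) (DivMod.[m+kn]%n≡m%n 3 t 4)

  3+4*-odd : ∀ t → (3+4* t) % 2 ≡ 1
  3+4*-odd t = trans (cong (λ m → (3 + m) % 2) (trans (ℕP.*-assoc 2 2 t) (ℕP.*-comm 2 (2 ℕ.* t)))) (DivMod.[m+kn]%n≡m%n 3 (2 ℕ.* t) 2)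

  next-3+4* : ∀ t → next (3+4* t) ≡ 3+4* t
  next-3+4* t rewrite 3+4*-odd t = ℕP.+-identityʳ (3+4* t)

  ∷ʳ≢[] : ∀ (π : List ℕ) {s} → π ∷ʳ s ≢ []
  ∷ʳ≢[] []      ()
  ∷ʳ≢[] (_ ∷ _) ()

  P34-∷ʳ : ∀ {t π} → Restricted (3+4* t) π → InP34 (π ∷ʳ 3+4* t)
  P34-∷ʳ {t} {π} restricted = record
    { partition    = record { positive = All.map (ℕP.≤-trans (s≤s z≤n)) ≥s
                            ; nonIncrease = Linked.AllPairs⇒Linked (AllPairs.map proj₁ ≽π) }
    ; nonEmpty     = ∷ʳ≢[] π
    ; evenDistinct = λ k k-even → mult-even≤1 (π ∷ʳ 3+4* t) ≽π k-even
    ; smallest     = 3+4* t , (∈-++⁺ʳ π (here refl) , ≥s) , 3+4*-%4 t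
    }
    where
    restricted′ : Restricted (3+4* t) (π ∷ʳ 3+4* t)
    restricted′ = restricted-∷ʳ⁺ (subst (λ s → Restricted s π) (sym (next-3+4* t)) restricted)
    ≥s : All (3+4* t ≤_) (π ∷ʳ 3+4* t)
    ≥s = proj₁ restricted′
    ≽π : AllPairs _≽_ (π ∷ʳ 3+4* t)
    ≽π = proj₂ restricted′

  P34-∷ʳ⁻ : ∀ {π} → InP34 π → ∃[ t ] ∃[ π′ ] (π ≡ π′ ∷ʳ 3+4* t × Restricted (3+4* t) π′)
  P34-∷ʳ⁻ {π} π∈P34 = by-last (initLast π) ≽π s∈π ≥s
    where
    open InP34 π∈P34
    open IsPartition partition
    s t : ℕ
    s = proj₁ smallest
    t = s ℕ./ 4
    s∈π : s ∈ π
    s∈π = proj₁ (proj₁ (proj₂ smallest))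
    ≥s : All (s ≤_) π
    ≥s = proj₂ (proj₁ (proj₂ smallest))
    s≡3+4*t : s ≡ 3+4* t
    s≡3+4*t = %4≡3⇒≡3+4* s (proj₂ (proj₂ smallest))
    ≽π : AllPairs _≽_ π
    ≽π = Linked.Linked⇒AllPairs ≽-trans (linked-≽ π nonIncrease evenDistinct)
    by-last : ∀ {π} → Data.List.InitLast π → AllPairs _≽_ π → s ∈ π → All (s ≤_) π →
              ∃[ t′ ] ∃[ π′ ] (π ≡ π′ ∷ʳ 3+4* t′ × Restricted (3+4* t′) π′)
    by-last [] _ () _
    by-last (π′ ∷ʳ′ x) ≽π s∈π ≥s = t , π′ , cong (π′ ∷ʳ_) (trans x≡s s≡3+4*t) ,
      subst (λ s′ → Restricted s′ π′) (trans (cong next s≡3+4*t) (next-3+4* t))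
        (restricted-∷ʳ⁻ (subst (λ x → Restricted s (π′ ∷ʳ x)) x≡s (≥s , ≽π)))
      where
      x≤s : x ≤ s
      x≤s with ∈-++⁻ π′ s∈π
      ... | inj₁ s∈π′          = proj₁ (All.lookup (proj₂ (AllPairs-∷ʳ⁻ {xs = π′} ≽π)) s∈π′)
      ... | inj₂ (here refl)   = ℕP.≤-refl
      x≡s : x ≡ s
      x≡s = ℕP.≤-antisym x≤s (proj₂ (All.∷ʳ⁻ {xs = π′} ≥s))

  withSmallest : ℕ → ℕ → List (List ℕ)
  withSmallest t N with 3+4* t ≤? N
  ... | yes _ = map (_∷ʳ 3+4* t) (restrictedPartitions (3+4* t) (N ∸ 3+4* t))
  ... | no  _ = []

  P34-below : ℕ → ℕ → List (List ℕ)
  P34-below zero    N = []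
  P34-below (suc T) N = P34-below T N ++ withSmallest T N

  ∈-withSmallest⁻ : ∀ t N {π} → π ∈ withSmallest t N → (InP34 π × size π ≡ N) × ∃[ π′ ] π ≡ π′ ∷ʳ 3+4* t
  ∈-withSmallest⁻ t N π∈ with 3+4* t ≤? N
  ... | no  _ with () ← π∈
  ... | yes s≤N with ∈-map⁻ (_∷ʳ 3+4* t) π∈
  ...   | π′ , π′∈ , refl with ∈-enumerate⁻ (fuel (3+4* t) (N ∸ 3+4* t)) (3+4* t) (N ∸ 3+4* t) π′∈
  ...     | restricted , size≡ =
    (P34-∷ʳ {t} restricted , trans (size-∷ʳ π′ (3+4* t)) (trans (cong (_+ 3+4* t) size≡) (ℕP.m∸n+n≡m s≤N))) , π′ , refl

  ∈-withSmallest⁺ : ∀ t N {π′} → Restricted (3+4* t) π′ → size (π′ ∷ʳ 3+4* t) ≡ N → π′ ∷ʳ 3+4* t ∈ withSmallest t N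
  ∈-withSmallest⁺ t N {π′} restricted size≡ with 3+4* t ≤? N
  ... | yes _  = ∈-map⁺ (_∷ʳ 3+4* t) (∈-enumerate⁺ (fuel (3+4* t) (N ∸ 3+4* t)) (3+4* t) (N ∸ 3+4* t) (s≤s z≤n) ℕP.≤-refl restricted
                   (trans (sym (ℕP.m+n∸n≡m (size π′) (3+4* t))) (cong (_∸ 3+4* t) (trans (sym (size-∷ʳ π′ (3+4* t))) size≡))))
  ... | no s≰N = contradiction (subst (3+4* t ≤_) size≡ (subst (3+4* t ≤_) (sym (size-∷ʳ π′ (3+4* t))) (ℕP.m≤n+m (3+4* t) (size π′)))) s≰N

  ∈-P34-below⁻ : ∀ T N {π} → π ∈ P34-below T N → (InP34 π × size π ≡ N) × ∃[ t ] (t < T × ∃[ π′ ] π ≡ π′ ∷ʳ 3+4* t)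
  ∈-P34-below⁻ (suc T) N π∈ with ∈-++⁻ (P34-below T N) π∈
  ... | inj₁ π∈₁ with ∈-P34-below⁻ T N π∈₁
  ...   | inP34 , t , t<T , π≡ = inP34 , t , ℕP.m≤n⇒m≤1+n t<T , π≡
  ∈-P34-below⁻ (suc T) N π∈ | inj₂ π∈₂ with ∈-withSmallest⁻ T N π∈₂
  ... | inP34 , π≡ = inP34 , T , ℕP.≤-refl , π≡

  ∈-P34-below⁺ : ∀ T N {t π} → t < T → π ∈ withSmallest t N → π ∈ P34-below T N
  ∈-P34-below⁺ (suc T) N t<1+T π∈ with ℕP.m≤n⇒m<n∨m≡n (ℕP.≤-pred t<1+T)
  ... | inj₁ t<T  = ∈-++⁺ˡ (∈-P34-below⁺ T N t<T π∈)
  ... | inj₂ refl = ∈-++⁺ʳ (P34-below T N) π∈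

  withSmallest-unique : ∀ t N → Unique (withSmallest t N)
  withSmallest-unique t N with 3+4* t ≤? N
  ... | yes _ = Unique.map⁺ ∷ʳ-injective (enumerate-unique (fuel (3+4* t) (N ∸ 3+4* t)) (3+4* t) (N ∸ 3+4* t))
  ... | no  _ = []

  P34-below-unique : ∀ T N → Unique (P34-below T N)
  P34-below-unique zero    N = []
  P34-below-unique (suc T) N = Unique.++⁺ (P34-below-unique T N) (withSmallest-unique T N) disjoint
    where
    disjoint : ∀ {π} → ¬ (π ∈ P34-below T N × π ∈ withSmallest T N)
    disjoint (π∈₁ , π∈₂) with ∈-P34-below⁻ T N π∈₁ | ∈-withSmallest⁻ T N π∈₂
    ... | _ , t , t<T , π₁ , π≡π₁∷ʳ | _ , π₂ , π≡π₂∷ʳ =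
      ℕP.<⇒≢ t<T (3+4*-injective (List.∷ʳ-injectiveʳ π₁ π₂ (trans (sym π≡π₁∷ʳ) π≡π₂∷ʳ)))

  P34-enumeration : ∀ N → Enumerates34 N (P34-below N N)
  P34-enumeration N = P34-below-unique N N , λ π → mk⇔ (proj₁ ∘ ∈-P34-below⁻ N N) (λ (inP34 , size≡) → complete inP34 size≡)
    where
    open import Function using (_∘_)
    complete : ∀ {π} → InP34 π → size π ≡ N → π ∈ P34-below N N
    complete inP34 size≡ with P34-∷ʳ⁻ inP34
    ... | t , π′ , refl , restricted = ∈-P34-below⁺ N N t<N (∈-withSmallest⁺ t N restricted size≡)
      where
      t<N : t < N
      t<N = ℕP.<-≤-trans (ℕP.≤-trans (s≤s (ℕP.m≤n*m t 4)) (ℕP.m≤n+m _ 2))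
              (subst (3+4* t ≤_) size≡ (subst (3+4* t ≤_) (sym (size-∷ʳ π′ (3+4* t))) (ℕP.m≤n+m (3+4* t) (size π′))))

  signedCount-withSmallest : ∀ t N → signedCount (withSmallest t N) ≡ -ᶻ shift (3+4* t) (G (3+4* t)) N
  signedCount-withSmallest t N with 3+4* t ≤? N
  ... | yes s≤N = trans (signedCount-∷ʳ (3+4* t) (restrictedPartitions (3+4* t) (N ∸ 3+4* t))) (cong -ᶻ_ (sym (shift-above (3+4* t) (G (3+4* t)) N s≤N)))
  ... | no  s≰N = sym (cong -ᶻ_ (shift-below (3+4* t) (G (3+4* t)) N (ℕP.≰⇒> s≰N)))

  smallestPartSeries : ℕ → Series
  smallestPartSeries T = sumBelow T (λ t → shift (3+4* t) (G (3+4* t)))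

  signedCount-P34 : ∀ N {ps} → Enumerates34 N ps → signedCount ps ≡ -ᶻ smallestPartSeries N N
  signedCount-P34 N {ps} (!ps , ps⇔) =
    trans (signedCount-≡ !ps (proj₁ (P34-enumeration N)) (λ {π} → ⇔-trans (ps⇔ π) (⇔-sym (proj₂ (P34-enumeration N) π)))) (below N)
    where
    below : ∀ T → signedCount (P34-below T N) ≡ -ᶻ smallestPartSeries T N
    below zero    = refl
    below (suc T) = trans (signedCount-++ (P34-below T N) _) (trans (cong₂ _+ᶻ_ (below T) (signedCount-withSmallest T N))
                      (sym (ℤP.neg-distrib-+ (smallestPartSeries T N) _)))

module GeneratingFunctions where

  open PowerSeries
  open GaussIdentity
  open RestrictedPartitions using (G; G-below; G-rec; next; %2-suc-suc; 3+4*_; smallestPartSeries)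
  open import Data.Nat as ℕ using (ℕ; zero; suc; _≤_; _<_; z≤n; s≤s; _∸_; _%_; _<?_)
  import Data.Nat.Properties as ℕP
  open import Data.Nat.Tactic.RingSolver using () renaming (solve to ℕ-solve)
  open import Data.Integer as ℤ using (0ℤ; 1ℤ; -1ℤ; +_) renaming (_+_ to _+ᶻ_; -_ to -ᶻ_)
  import Data.Integer.Properties as ℤP
  open import Data.Integer.Tactic.RingSolver using () renaming (solve-∀ to ℤ-solve-∀)
  open import Data.List using ([]; _∷_)
  open import Relation.Binary.PropositionalEquality as ≡ using (_≡_; refl)
  open import Relation.Nullary using (yes; no)
  open ≈-Reasoning

  2*_ : ℕ → ℕ
  2* zero  = zero
  2* suc n = suc (suc (2* n))

  2*-≡ : ∀ n → 2* n ≡ n ℕ.+ n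
  2*-≡ zero    = refl
  2*-≡ (suc n) = ≡.cong suc (≡.trans (≡.cong suc (2*-≡ n)) (≡.sym (ℕP.+-suc n n)))

  n≤2*n : ∀ n → n ≤ 2* n
  n≤2*n zero    = z≤n
  n≤2*n (suc n) = s≤s (ℕP.m≤n⇒m≤1+n (n≤2*n n))

  n<2*[1+n] : ∀ n → n < 2* suc n
  n<2*[1+n] n = s≤s (ℕP.m≤n⇒m≤1+n (n≤2*n n))

  2*-even : ∀ n → 2* n % 2 ≡ 0
  2*-even zero    = refl
  2*-even (suc n) = ≡.trans (%2-suc-suc (2* n)) (2*-even n)

  2*+1-odd : ∀ n → suc (2* n) % 2 ≡ 1
  2*+1-odd zero    = refl
  2*+1-odd (suc n) = ≡.trans (%2-suc-suc (suc (2* n))) (2*+1-odd n)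

  next-odd : ∀ n → next (suc (2* n)) ≡ suc (2* n)
  next-odd n = ≡.trans (≡.cong (λ r → suc (2* n) ℕ.+ (1 ∸ r)) (2*+1-odd n)) (ℕP.+-identityʳ _)

  next-even : ∀ n → next (2* suc n) ≡ suc (2* suc n)
  next-even n = ≡.trans (≡.cong (λ r → 2* suc n ℕ.+ (1 ∸ r)) (2*-even (suc n))) (ℕP.+-comm _ 1)

  G-recurrence : ∀ s → 1 ≤ s → G s ≈ G (suc s) ⊕ ⊖ (X^ s ⊛ G (next s))
  G-recurrence s 1≤s n with n <? s
  ... | yes n<s = ≡.trans (G-below s n 1≤s n<s) (≡.sym (≡.trans
        (≡.cong₂ _+ᶻ_ (G-below (suc s) n (s≤s z≤n) (ℕP.m≤n⇒m≤1+n n<s))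
                       (≡.cong -ᶻ_ (≡.trans (X^⊛≈shift s (G (next s)) n) (shift-below s (G (next s)) n n<s))))
        (ℤP.+-identityʳ (𝟙 n))))
  ... | no n≮s = ≡.trans (G-rec s n 1≤s (ℕP.≮⇒≥ n≮s)) (≡.cong (λ c → G (suc s) n +ᶻ -ᶻ c)
        (≡.sym (≡.trans (X^⊛≈shift s (G (next s)) n) (shift-above s (G (next s)) n (ℕP.≮⇒≥ n≮s)))))

  G-odd : ∀ n → G (suc (2* n)) ⊕ X^ (suc (2* n)) ⊛ G (suc (2* n)) ≈ G (2* suc n)
  G-odd n = begin
      G s ⊕ X^ s ⊛ G s
    ≈⟨ ⊕-congʳ (G-recurrence s (s≤s z≤n)) ⟩
      G (suc s) ⊕ ⊖ (X^ s ⊛ G (next s)) ⊕ X^ s ⊛ G s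
    ≡⟨ ≡.cong (λ r → G (suc s) ⊕ ⊖ (X^ s ⊛ G r) ⊕ X^ s ⊛ G s) (next-odd n) ⟩
      G (suc s) ⊕ ⊖ (X^ s ⊛ G s) ⊕ X^ s ⊛ G s
    ≈⟨ (λ i → cancel (G (suc s) i) ((X^ s ⊛ G s) i)) ⟩
      G (suc s)
    ∎
    where
    s : ℕ
    s = suc (2* n)
    cancel : ∀ a b → a +ᶻ -ᶻ b +ᶻ b ≡ a
    cancel = ℤ-solve-∀

  G-even : ∀ n → G (2* suc n) ≈ G (suc (2* suc n)) ⊕ ⊖ (X^ (2* suc n) ⊛ G (suc (2* suc n)))
  G-even n = ≈-trans (G-recurrence (2* suc n) (s≤s z≤n)) (≡⇒≈ (≡.cong (λ r → G (suc (2* suc n)) ⊕ ⊖ (X^ (2* suc n) ⊛ G r)) (next-even n)))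

  G≈[]𝟙 : ∀ s N → 1 ≤ s → N < s → G s ≈[ N ] 𝟙
  G≈[]𝟙 s N 1≤s N<s n n≤N = G-below s n 1≤s (ℕP.≤-<-trans n≤N N<s)

  oddTerm : ℕ → Series
  oddTerm n = X^ (suc (2* n)) ⊛ G (suc (2* n))

  oddSum : ℕ → Series
  oddSum K = sumBelow K oddTerm

  1+X⊛oddSum : ∀ M → 1+X^ 1 ⊛ oddSum (suc M) ≈ X^ 1 ⊛ G (2* suc M)
  1+X⊛oddSum zero = begin
      (𝟙 ⊕ X^ 1) ⊛ (𝟘 ⊕ X^ 1 ⊛ G 1)
    ≈⟨ ⊛-congˡ (⊕-identityˡ (X^ 1 ⊛ G 1)) ⟩
      (𝟙 ⊕ X^ 1) ⊛ (X^ 1 ⊛ G 1)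
    ≈⟨ solve 2 (λ x g → (con 1ℤ :+ x) :* (x :* g) := x :* (g :+ x :* g)) ≈-refl (X^ 1) (G 1) ⟩
      X^ 1 ⊛ (G 1 ⊕ X^ 1 ⊛ G 1)
    ≈⟨ ⊛-congˡ (G-odd 0) ⟩
      X^ 1 ⊛ G 2
    ∎
  1+X⊛oddSum (suc M) = begin
      (𝟙 ⊕ X^ 1) ⊛ (oddSum (suc M) ⊕ X^ (suc b) ⊛ G (suc b))
    ≈⟨ ⊛-congˡ {𝟙 ⊕ X^ 1} (⊕-congˡ {oddSum (suc M)} (⊛-congʳ (≈-sym (X^-+ 1 b)))) ⟩
      (𝟙 ⊕ X^ 1) ⊛ (oddSum (suc M) ⊕ (X^ 1 ⊛ X^ b) ⊛ G (suc b))
    ≈⟨ solve 4 (λ x U y g → (con 1ℤ :+ x) :* (U :+ (x :* y) :* g) := (con 1ℤ :+ x) :* U :+ (con 1ℤ :+ x) :* (x :* y) :* g)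
         ≈-refl (X^ 1) (oddSum (suc M)) (X^ b) (G (suc b)) ⟩
      (𝟙 ⊕ X^ 1) ⊛ oddSum (suc M) ⊕ (𝟙 ⊕ X^ 1) ⊛ (X^ 1 ⊛ X^ b) ⊛ G (suc b)
    ≈⟨ ⊕-congʳ (≈-trans (1+X⊛oddSum M) (⊛-congˡ (G-even M))) ⟩
      X^ 1 ⊛ (G (suc b) ⊕ ⊖ (X^ b ⊛ G (suc b))) ⊕ (𝟙 ⊕ X^ 1) ⊛ (X^ 1 ⊛ X^ b) ⊛ G (suc b)
    ≈⟨ solve 3 (λ x y g → x :* (g :- y :* g) :+ (con 1ℤ :+ x) :* (x :* y) :* g := x :* (g :+ (x :* y) :* g)) ≈-refl (X^ 1) (X^ b) (G (suc b)) ⟩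
      X^ 1 ⊛ (G (suc b) ⊕ (X^ 1 ⊛ X^ b) ⊛ G (suc b))
    ≈⟨ ⊛-congˡ {X^ 1} (≈-trans (⊕-congˡ {G (suc b)} (⊛-congʳ (X^-+ 1 b))) (G-odd (suc M))) ⟩
      X^ 1 ⊛ G (2* suc (suc M))
    ∎
    where
    b : ℕ
    b = 2* suc M

  -- wSum _ 1 is the series W = (1 - X)⁻¹ θ; the parameter k lets (-X; X) be absorbed one factor at a time.
  wTerm : ℕ → ℕ → Series
  wTerm k n = const (sgn n) ⊛ X^ (n ℕ.* 2* k) ⊛ G (suc (2* n))

  wSum : ℕ → ℕ → Series
  wSum K k = sumBelow K (wTerm k)

  wError : ℕ → ℕ → Series
  wError k M = const (sgn M) ⊛ X^ (suc M ℕ.* 2* k) ⊛ (1+X^ (suc (2* M)) ⊛ G (suc (2* M)))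

  wSum-step : ∀ k M → 1+X^ (2* k) ⊛ wSum (suc M) k ≈ 1-X^ (suc (2* k)) ⊛ wSum (suc M) (suc k) ⊕ wError k M
  wSum-step k zero = begin
      (𝟙 ⊕ a) ⊛ (𝟘 ⊕ 𝟙 ⊛ 𝟙 ⊛ G 1)
    ≈⟨ ⊛-congˡ {𝟙 ⊕ a} (⊕-identityˡ (𝟙 ⊛ 𝟙 ⊛ G 1)) ⟩
      (𝟙 ⊕ a) ⊛ (𝟙 ⊛ 𝟙 ⊛ G 1)
    ≈⟨ solve 3 (λ a x g → (con 1ℤ :+ a) :* (con 1ℤ :* con 1ℤ :* g) := (con 1ℤ :- x :* a) :* (con 1ℤ :* con 1ℤ :* g) :+ con 1ℤ :* a :* ((con 1ℤ :+ x) :* g))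
         ≈-refl a (X^ 1) (G 1) ⟩
      (𝟙 ⊕ ⊖ (X^ 1 ⊛ a)) ⊛ (𝟙 ⊛ 𝟙 ⊛ G 1) ⊕ 𝟙 ⊛ a ⊛ ((𝟙 ⊕ X^ 1) ⊛ G 1)
    ≈⟨ ⊕-cong (⊛-cong (⊕-congˡ {𝟙} (⊖-cong (X^-+ 1 (2* k)))) (≈-sym (⊕-identityˡ (𝟙 ⊛ 𝟙 ⊛ G 1))))
              (⊛-congʳ (⊛-congˡ {𝟙} (X^-cong (≡.sym (ℕP.+-identityʳ (2* k)))))) ⟩
      1-X^ (suc (2* k)) ⊛ wSum 1 (suc k) ⊕ wError k 0
    ∎
    where
    a : Series
    a = X^ (2* k)
  wSum-step k (suc M) = begin
      (𝟙 ⊕ a) ⊛ (W₁ ⊕ const (-ᶻ sgn M) ⊛ y ⊛ G′)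
    ≈⟨ ⊛-congˡ {𝟙 ⊕ a} (⊕-congˡ {W₁} (⊛-congʳ (⊛-congʳ (const-neg (sgn M))))) ⟩
      (𝟙 ⊕ a) ⊛ (W₁ ⊕ ⊖ σ ⊛ y ⊛ G′)
    ≈⟨ solve 5 (λ a W σ y g → (con 1ℤ :+ a) :* (W :+ :- σ :* y :* g) := (con 1ℤ :+ a) :* W :+ (con 1ℤ :+ a) :* (:- σ :* y :* g)) ≈-refl a W₁ σ y G′ ⟩
      (𝟙 ⊕ a) ⊛ W₁ ⊕ (𝟙 ⊕ a) ⊛ (⊖ σ ⊛ y ⊛ G′)
    ≈⟨ ⊕-congʳ (≈-trans (wSum-step k M) (⊕-cong (⊛-congʳ (⊕-congˡ {𝟙} (⊖-cong (≈-sym (X^-+ 1 (2* k)))))) error)) ⟩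
      ((𝟙 ⊕ ⊖ (x ⊛ a)) ⊛ W₂ ⊕ σ ⊛ y ⊛ (G′ ⊕ ⊖ (b ⊛ G′))) ⊕ (𝟙 ⊕ a) ⊛ (⊖ σ ⊛ y ⊛ G′)
    ≈⟨ solve 7 (λ a x b W σ y g → ((con 1ℤ :- x :* a) :* W :+ σ :* y :* (g :- b :* g)) :+ (con 1ℤ :+ a) :* (:- σ :* y :* g)
          := (con 1ℤ :- x :* a) :* (W :+ :- σ :* (y :* b) :* g) :+ :- σ :* (a :* y) :* ((con 1ℤ :+ x :* b) :* g)) ≈-refl a x b W₂ σ y G′ ⟩
      (𝟙 ⊕ ⊖ (x ⊛ a)) ⊛ (W₂ ⊕ ⊖ σ ⊛ (y ⊛ b) ⊛ G′) ⊕ ⊖ σ ⊛ (a ⊛ y) ⊛ ((𝟙 ⊕ x ⊛ b) ⊛ G′)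
    ≈⟨ ⊕-cong (⊛-cong (⊕-congˡ {𝟙} (⊖-cong (X^-+ 1 (2* k))))
                      (⊕-congˡ {W₂} (⊛-congʳ (⊛-cong (≈-sym (const-neg (sgn M))) (≈-trans (X^-+ (suc M ℕ.* 2* k) (2* suc M)) (X^-cong exponent))))))
              (⊛-cong (⊛-cong (≈-sym (const-neg (sgn M))) (X^-+ (2* k) (suc M ℕ.* 2* k))) (⊛-congʳ (⊕-congˡ {𝟙} (X^-+ 1 (2* suc M))))) ⟩
      1-X^ (suc (2* k)) ⊛ wSum (suc (suc M)) (suc k) ⊕ wError k (suc M)
    ∎
    where
    a x b y σ G′ W₁ W₂ : Series
    a  = X^ (2* k)
    x  = X^ 1
    b  = X^ (2* suc M)
    y  = X^ (suc M ℕ.* 2* k)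
    σ  = const (sgn M)
    G′ = G (suc (2* suc M))
    W₁ = wSum (suc M) k
    W₂ = wSum (suc M) (suc k)
    error : wError k M ≈ σ ⊛ y ⊛ (G′ ⊕ ⊖ (b ⊛ G′))
    error = ⊛-congˡ {σ ⊛ y} (≈-trans (solve 2 (λ c g → (con 1ℤ :+ c) :* g := g :+ c :* g) ≈-refl (X^ (suc (2* M))) (G (suc (2* M))))
              (≈-trans (G-odd M) (G-even M)))
    exponent : suc M ℕ.* 2* k ℕ.+ 2* suc M ≡ suc M ℕ.* 2* suc k
    exponent rewrite 2*-≡ k | 2*-≡ M = ℕ-solve (M ∷ k ∷ [])

  const⊛X^⊛≈[]𝟘 : ∀ a c f N → N < c → const a ⊛ X^ c ⊛ f ≈[ N ] 𝟘
  const⊛X^⊛≈[]𝟘 a c f N N<c = ≈[]-trans (≈⇒≈[] (solve 3 (λ a x f → a :* x :* f := x :* (a :* f)) ≈-refl (const a) (X^ c) f))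
    (X^⊛≈[]𝟘 c (const a ⊛ f) N N<c)

  wSum-step[] : ∀ k N → 1+X^ (2* suc k) ⊛ wSum (suc N) (suc k) ≈[ N ] 1-X^ (suc (2* suc k)) ⊛ wSum (suc N) (suc (suc k))
  wSum-step[] k N = ≈[]-trans (≈⇒≈[] (wSum-step (suc k) N))
    (⊕-𝟘[] (const⊛X^⊛≈[]𝟘 (sgn N) _ _ N (ℕP.m≤m*n (suc N) (2* suc k))))

  wSum≈[]G₁ : ∀ k M N → N < 2* k → wSum (suc M) k ≈[ N ] G 1
  wSum≈[]G₁ k zero    N N<2k = ≈⇒≈[] (≈-trans (⊕-identityˡ _) (solve 1 (λ g → con 1ℤ :* con 1ℤ :* g := g) ≈-refl (G 1)))
  wSum≈[]G₁ k (suc M) N N<2k = ≈[]-trans (⊕-𝟘[] (const⊛X^⊛≈[]𝟘 (sgn (suc M)) _ _ N (ℕP.<-≤-trans N<2k (ℕP.m≤m+n (2* k) _))))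
    (wSum≈[]G₁ k M N N<2k)

  evenPlus oddMinus oddPlus evenMinus : ℕ → Series
  evenPlus  zero    = 𝟙
  evenPlus  (suc K) = evenPlus K ⊛ 1+X^ (2* suc K)
  oddMinus  zero    = 𝟙
  oddMinus  (suc K) = oddMinus K ⊛ 1-X^ (suc (2* suc K))
  oddPlus   zero    = 𝟙
  oddPlus   (suc K) = oddPlus K ⊛ 1+X^ (suc (2* K))
  evenMinus zero    = 𝟙
  evenMinus (suc K) = evenMinus K ⊛ 1-X^ (2* suc K)

  evenPlus⊛wSum[] : ∀ N K → evenPlus K ⊛ wSum (suc N) 1 ≈[ N ] oddMinus K ⊛ wSum (suc N) (suc K)
  evenPlus⊛wSum[] N zero    = ≈[]-refl
  evenPlus⊛wSum[] N (suc K) =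
    ≈[]-trans (≈⇒≈[] (solve 3 (λ e a w → e :* a :* w := a :* (e :* w)) ≈-refl (evenPlus K) A (wSum (suc N) 1)))
    (≈[]-trans (⊛-cong[] (≈[]-refl {A}) (evenPlus⊛wSum[] N K))
    (≈[]-trans (≈⇒≈[] (solve 3 (λ o a w → a :* (o :* w) := o :* (a :* w)) ≈-refl (oddMinus K) A (wSum (suc N) (suc K))))
    (≈[]-trans (⊛-cong[] (≈[]-refl {oddMinus K}) (wSum-step[] K N))
    (≈⇒≈[] (≈-sym (⊛-assoc (oddMinus K) _ _))))))
    where
    A : Series
    A = 1+X^ (2* suc K)

  oddPlus⊛G₁ : ∀ K → oddPlus (suc K) ⊛ G 1 ≈ evenMinus K ⊛ G (2* suc K)
  oddPlus⊛G₁ zero    = ≈-trans (solve 2 (λ x g → con 1ℤ :* (con 1ℤ :+ x) :* g := con 1ℤ :* (g :+ x :* g)) ≈-refl (X^ 1) (G 1))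
                         (⊛-congˡ {𝟙} (G-odd 0))
  oddPlus⊛G₁ (suc K) = begin
      oddPlus (suc K) ⊛ B ⊛ G 1
    ≈⟨ solve 3 (λ o b g → o :* b :* g := b :* (o :* g)) ≈-refl (oddPlus (suc K)) B (G 1) ⟩
      B ⊛ (oddPlus (suc K) ⊛ G 1)
    ≈⟨ ⊛-congˡ {B} (≈-trans (oddPlus⊛G₁ K) (⊛-congˡ {evenMinus K} (G-even K))) ⟩
      B ⊛ (evenMinus K ⊛ (G′ ⊕ ⊖ (X^ (2* suc K) ⊛ G′)))
    ≈⟨ solve 4 (λ e g c x → (con 1ℤ :+ x) :* (e :* (g :- c :* g)) := e :* (con 1ℤ :- c) :* (g :+ x :* g))
         ≈-refl (evenMinus K) G′ (X^ (2* suc K)) (X^ (suc (2* suc K))) ⟩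
      evenMinus (suc K) ⊛ (G′ ⊕ X^ (suc (2* suc K)) ⊛ G′)
    ≈⟨ ⊛-congˡ {evenMinus (suc K)} (G-odd (suc K)) ⟩
      evenMinus (suc K) ⊛ G (2* suc (suc K))
    ∎
    where
    B G′ : Series
    B  = 1+X^ (suc (2* suc K))
    G′ = G (suc (2* suc K))

  plusPoch-split : ∀ K → plusPoch (suc (2* K)) ≈ oddPlus (suc K) ⊛ evenPlus K
  plusPoch-split zero    = solve 1 (λ x → con 1ℤ :* (con 1ℤ :+ x) := con 1ℤ :* (con 1ℤ :+ x) :* con 1ℤ) ≈-refl (X^ 1)
  plusPoch-split (suc K) = begin
      plusPoch (suc (2* K)) ⊛ 1+X^ (2* suc K) ⊛ 1+X^ (suc (2* suc K))
    ≈⟨ ⊛-congʳ (⊛-congʳ (plusPoch-split K)) ⟩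
      oddPlus (suc K) ⊛ evenPlus K ⊛ 1+X^ (2* suc K) ⊛ 1+X^ (suc (2* suc K))
    ≈⟨ solve 4 (λ o e a b → o :* e :* a :* b := o :* b :* (e :* a)) ≈-refl (oddPlus (suc K)) (evenPlus K) (1+X^ (2* suc K)) (1+X^ (suc (2* suc K))) ⟩
      oddPlus (suc (suc K)) ⊛ evenPlus (suc K)
    ∎

  qPoch-split : ∀ K → qPoch 1 (suc (2* K)) ≈ 1-X^ 1 ⊛ oddMinus K ⊛ evenMinus K
  qPoch-split zero    = solve 1 (λ x → (con 1ℤ :- x) :* con 1ℤ := (con 1ℤ :- x) :* con 1ℤ :* con 1ℤ) ≈-refl (X^ 1)
  qPoch-split (suc K) = begin
      qPoch 1 (suc (2* suc K))
    ≈⟨ ≈-trans (qPoch-snoc 1 (2* suc K)) (⊛-congʳ (qPoch-snoc 1 (suc (2* K)))) ⟩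
      qPoch 1 (suc (2* K)) ⊛ 1-X^ (2* suc K) ⊛ 1-X^ (suc (2* suc K))
    ≈⟨ ⊛-congʳ (⊛-congʳ (qPoch-split K)) ⟩
      1-X^ 1 ⊛ oddMinus K ⊛ evenMinus K ⊛ 1-X^ (2* suc K) ⊛ 1-X^ (suc (2* suc K))
    ≈⟨ solve 5 (λ m o e a b → m :* o :* e :* a :* b := m :* (o :* b) :* (e :* a))
         ≈-refl (1-X^ 1) (oddMinus K) (evenMinus K) (1-X^ (2* suc K)) (1-X^ (suc (2* suc K))) ⟩
      1-X^ 1 ⊛ oddMinus (suc K) ⊛ evenMinus (suc K)
    ∎

  plusPoch-constant : ∀ n → plusPoch n 0 ≡ 1ℤ
  plusPoch-constant zero    = refl
  plusPoch-constant (suc n) = ≡.cong (ℤ._* 1ℤ) (plusPoch-constant n)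

  -- Multiplying by (-X; X)_{2N+1} turns both sides into (X; X)_{2N+1} modulo X^(N+1): the left one by the
  -- product manipulations above, the right one by Gauss's identity; (-X; X) has constant term 1, so it cancels.
  1-X⊛wSum≈[]theta : ∀ N → 1-X^ 1 ⊛ wSum (suc N) 1 ≈[ N ] theta (suc (2* N))
  1-X⊛wSum≈[]theta N n n≤N = ℤP.i-j≡0⇒i≡j _ _ (⊛-cancelˡ[] {h = P} (plusPoch-constant (suc (2* N))) difference n n≤N)
    where
    P W : Series
    P = plusPoch (suc (2* N))
    W = wSum (suc N) 1
    P⊛1-X⊛W : P ⊛ (1-X^ 1 ⊛ W) ≈[ N ] qPoch 1 (suc (2* N))
    P⊛1-X⊛W =
      ≈[]-trans (≈⇒≈[] (≈-trans (⊛-congʳ (plusPoch-split N))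
        (solve 4 (λ o e m w → o :* e :* (m :* w) := m :* o :* (e :* w)) ≈-refl (oddPlus (suc N)) (evenPlus N) (1-X^ 1) W)))
      (≈[]-trans (⊛-cong[] (≈[]-refl {1-X^ 1 ⊛ oddPlus (suc N)}) (evenPlus⊛wSum[] N N))
      (≈[]-trans (⊛-cong[] (≈[]-refl {1-X^ 1 ⊛ oddPlus (suc N)})
        (⊛-cong[] (≈[]-refl {oddMinus N}) (wSum≈[]G₁ (suc N) N N (n<2*[1+n] N))))
      (≈[]-trans (≈⇒≈[] (≈-trans (solve 4 (λ m o d g → m :* o :* (d :* g) := m :* d :* (o :* g)) ≈-refl (1-X^ 1) (oddPlus (suc N)) (oddMinus N) (G 1))
        (⊛-congˡ {1-X^ 1 ⊛ oddMinus N} (oddPlus⊛G₁ N))))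
      (≈[]-trans (⊛-cong[] (≈[]-refl {1-X^ 1 ⊛ oddMinus N}) (⊛-cong[] (≈[]-refl {evenMinus N}) (G≈[]𝟙 (2* suc N) N (s≤s z≤n) (n<2*[1+n] N))))
      (≈⇒≈[] (≈-trans (⊛-congˡ {1-X^ 1 ⊛ oddMinus N} (⊛-identityʳ (evenMinus N))) (≈-sym (qPoch-split N))))))))
    difference : P ⊛ (1-X^ 1 ⊛ W ⊕ ⊖ theta (suc (2* N))) ≈[ N ] 𝟘
    difference =
      ≈[]-trans (≈⇒≈[] (solve 3 (λ p a t → p :* (a :- t) := p :* a :- p :* t) ≈-refl P (1-X^ 1 ⊛ W) (theta (suc (2* N)))))
      (≈[]-trans (⊕-cong[] P⊛1-X⊛W (⊖-cong[] (≈[]-mono (ℕP.m≤n⇒m≤1+n (n≤2*n N)) (gauss-identity[] (suc (2* N))))))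
      (≈⇒≈[] (⊖-inverseʳ (qPoch 1 (suc (2* N))))))

  sgn-2* : ∀ n → sgn (2* n) ≡ 1ℤ
  sgn-2* zero    = refl
  sgn-2* (suc n) = ≡.trans (ℤP.neg-involutive (sgn (2* n))) (sgn-2* n)

  3+4*≡ : ∀ t → 3+4* t ≡ suc (2* suc (2* t))
  3+4*≡ t rewrite 2*-≡ t | 2*-≡ (t ℕ.+ t) = ℕ-solve (t ∷ [])

  smallestTerms : ℕ → Series
  smallestTerms T = sumBelow T (λ t → X^ (3+4* t) ⊛ G (3+4* t))

  smallestTerms≈smallestPartSeries : ∀ T → smallestTerms T ≈ smallestPartSeries T
  smallestTerms≈smallestPartSeries zero    = ≈-refl
  smallestTerms≈smallestPartSeries (suc T) = ⊕-cong (smallestTerms≈smallestPartSeries T) (X^⊛≈shift (3+4* T) (G (3+4* T)))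

  -- U - X W keeps, doubled, the terms of U = oddSum with n odd, i.e. those with parts 2n + 1 = 3 + 4t.
  pairing : ∀ T → const (+ 2) ⊛ smallestTerms T ≈ oddSum (2* T) ⊕ ⊖ (X^ 1 ⊛ wSum (2* T) 1)
  pairing zero    n = ≡.trans (⊛-zeroʳ (const (+ 2)) n) (≡.sym (≡.cong (λ c → 0ℤ +ᶻ -ᶻ c) (⊛-zeroʳ (X^ 1) n)))
  pairing (suc T) = begin
      const (+ 2) ⊛ (smallestTerms T ⊕ X^ (3+4* T) ⊛ G (3+4* T))
    ≡⟨ ≡.cong (λ s → const (+ 2) ⊛ (smallestTerms T ⊕ X^ s ⊛ G s)) (3+4*≡ T) ⟩
      const (+ 2) ⊛ (smallestTerms T ⊕ u₂)
    ≈⟨ solve 3 (λ t S u → t :* (S :+ u) := t :* S :+ t :* u) ≈-refl (const (+ 2)) (smallestTerms T) u₂ ⟩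
      const (+ 2) ⊛ smallestTerms T ⊕ const (+ 2) ⊛ u₂
    ≈⟨ ⊕-congʳ (pairing T) ⟩
      U ⊕ ⊖ (X^ 1 ⊛ W) ⊕ const (+ 2) ⊛ u₂
    ≈⟨ solve 5 (λ U x W u₁ u₂ → U :- x :* W :+ con (+ 2) :* u₂ := (U :+ u₁ :+ u₂) :- (x :* W :+ con 1ℤ :* u₁ :+ con -1ℤ :* u₂))
         ≈-refl U (X^ 1) W u₁ u₂ ⟩
      (U ⊕ u₁ ⊕ u₂) ⊕ ⊖ (X^ 1 ⊛ W ⊕ const 1ℤ ⊛ u₁ ⊕ const -1ℤ ⊛ u₂)
    ≈⟨ ⊕-congˡ {U ⊕ u₁ ⊕ u₂} (⊖-cong (≈-sym (≈-trans
         (solve 4 (λ x W a b → x :* (W :+ a :+ b) := x :* W :+ x :* a :+ x :* b) ≈-refl (X^ 1) W (wTerm 1 (2* T)) (wTerm 1 (suc (2* T))))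
         (⊕-cong (⊕-congˡ {X^ 1 ⊛ W} (≈-trans (X⊛wTerm₁ (2* T)) (⊛-congʳ (≡⇒≈ (≡.cong const (sgn-2* T))))))
                 (≈-trans (X⊛wTerm₁ (suc (2* T))) (⊛-congʳ (≡⇒≈ (≡.cong (λ c → const (-ᶻ c)) (sgn-2* T))))))))) ⟩
      oddSum (2* suc T) ⊕ ⊖ (X^ 1 ⊛ wSum (2* suc T) 1)
    ∎
    where
    U W u₁ u₂ : Series
    U  = oddSum (2* T)
    W  = wSum (2* T) 1
    u₁ = oddTerm (2* T)
    u₂ = oddTerm (suc (2* T))
    X⊛wTerm₁ : ∀ n → X^ 1 ⊛ wTerm 1 n ≈ const (sgn n) ⊛ oddTerm n
    X⊛wTerm₁ n = ≈-trans (solve 4 (λ x s y g → x :* (s :* y :* g) := s :* ((x :* y) :* g)) ≈-refl (X^ 1) (const (sgn n)) (X^ (n ℕ.* 2)) (G (suc (2* n))))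
      (⊛-congˡ {const (sgn n)} (⊛-congʳ (≈-trans (X^-+ 1 (n ℕ.* 2)) (X^-cong (≡.cong suc n*2≡2*n)))))
      where
      n*2≡2*n : n ℕ.* 2 ≡ 2* n
      n*2≡2*n rewrite 2*-≡ n = ℕ-solve (n ∷ [])

module Coefficients where

  open PowerSeries
  open GaussIdentity
  open GeneratingFunctions
  open RestrictedPartitions using (smallestPartSeries)
  open import Data.Nat as ℕ using (ℕ; zero; suc; _≤_; _<_; z≤n; s≤s)
  import Data.Nat.Properties as ℕP
  open import Data.Integer as ℤ using (0ℤ; 1ℤ; +_) renaming (_+_ to _+ᶻ_; _*_ to _*ᶻ_; -_ to -ᶻ_)
  import Data.Integer.Properties as ℤP
  open import Data.Integer.Tactic.RingSolver using () renaming (solve-∀ to ℤ-solve-∀)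
  open import Relation.Binary.PropositionalEquality as ≡ using (_≡_; _≢_; refl)
  open import Relation.Nullary using (yes; no)
  open import Relation.Binary using (tri<; tri≈; tri>)
  open import Data.Sum using (inj₁; inj₂)
  open import Algebra.Properties.AbelianGroup ℤP.+-0-abelianGroup using () renaming (inverseˡ-unique to ℤ-inverseˡ-unique)
  open ≡.≡-Reasoning

  1+X⊛-coefficient : ∀ f n → (1+X^ 1 ⊛ f) n ≡ f n +ᶻ shift 1 f n
  1+X⊛-coefficient f = ≈-trans (solve 2 (λ x f → (con 1ℤ :+ x) :* f := con 1ℤ :* f :+ x :* f) ≈-refl (X^ 1) f)
                         (⊕-cong (⊛-identityˡ f) (X^⊛≈shift 1 f))

  1-X⊛-coefficient : ∀ f n → (1-X^ 1 ⊛ f) n ≡ f n +ᶻ -ᶻ shift 1 f n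
  1-X⊛-coefficient f = ≈-trans (solve 2 (λ x f → (con 1ℤ :- x) :* f := con 1ℤ :* f :- x :* f) ≈-refl (X^ 1) f)
                         (⊕-cong (⊛-identityˡ f) (⊖-cong (X^⊛≈shift 1 f)))

  -- (1 + X) · oddSum ≡ X, so the coefficients of oddSum alternate.
  oddSum-coefficient : ∀ M m → suc m ≤ 2* suc M → oddSum (suc M) (suc m) ≡ sgn m
  oddSum-coefficient M = coefficient
    where
    U : Series
    U = oddSum (suc M)
    1+X⊛U : ∀ n → n ≤ 2* suc M → U n +ᶻ shift 1 U n ≡ (X^ 1) n
    1+X⊛U n n≤ = ≡.trans (≡.sym (1+X⊛-coefficient U n)) (≡.trans (1+X⊛oddSum M n)
                   (≡.trans (X^⊛-cong[] 1 (G≈[]𝟙 (2* suc M) (suc (2* M)) (s≤s z≤n) ℕP.≤-refl) n n≤) (⊛-identityʳ (X^ 1) n)))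
    U₀≡0 : U 0 ≡ 0ℤ
    U₀≡0 = ≡.trans (≡.sym (ℤP.+-identityʳ (U 0))) (1+X⊛U 0 z≤n)
    coefficient : ∀ m → suc m ≤ 2* suc M → U (suc m) ≡ sgn m
    coefficient zero    le = ≡.trans (≡.sym (ℤP.+-identityʳ (U 1))) (≡.trans (≡.cong (U 1 +ᶻ_) (≡.sym U₀≡0)) (1+X⊛U 1 le))
    coefficient (suc m) le = ≡.trans (ℤ-inverseˡ-unique _ _ (1+X⊛U (suc (suc m)) le)) (≡.cong -ᶻ_ (coefficient m (ℕP.≤-trans (ℕP.n≤1+n _) le)))

  square-< : ∀ {j k} → j < k → j ℕ.* j < k ℕ.* k
  square-< j<k = ℕP.*-mono-< j<k j<k

  thetaSum-nonsquare : ∀ n i → (∀ j → j < n → suc j ℕ.* suc j ≢ i) → sumBelow n thetaTerm i ≡ 0ℤ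
  thetaSum-nonsquare zero    i _          = refl
  thetaSum-nonsquare (suc n) i nonsquare = ≡.cong₂ _+ᶻ_
    (thetaSum-nonsquare n i (λ j j<n → nonsquare j (ℕP.m≤n⇒m≤1+n j<n)))
    (const⊛X^-offDiagonal (sgn (suc n)) (suc n ℕ.* suc n) i (λ eq → nonsquare n ℕP.≤-refl (≡.sym eq)))

  thetaSum-square : ∀ n j → j < n → sumBelow n thetaTerm (suc j ℕ.* suc j) ≡ sgn (suc j)
  thetaSum-square (suc n) j j<1+n with ℕP.m≤n⇒m<n∨m≡n (ℕP.≤-pred j<1+n)
  ... | inj₂ refl = ≡.trans (≡.cong₂ _+ᶻ_ (thetaSum-nonsquare n _ (λ i i<j eq → ℕP.<-irrefl eq (square-< (s≤s i<j))))
                                          (const⊛X^-diagonal (sgn (suc j)) (suc j ℕ.* suc j)))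
                            (ℤP.+-identityˡ _)
  ... | inj₁ j<n  = ≡.trans (≡.cong₂ _+ᶻ_ (thetaSum-square n j j<n)
                                          (const⊛X^-offDiagonal (sgn (suc n)) _ _ (λ eq → ℕP.<-irrefl eq (square-< (s≤s j<n)))))
                            (ℤP.+-identityʳ _)

  theta-coefficient : ∀ n i → theta n i ≡ 𝟙 i +ᶻ + 2 *ᶻ sumBelow n thetaTerm i
  theta-coefficient n i = ≡.cong (𝟙 i +ᶻ_) (const-⊛ (+ 2) _ i)

  -- (1 - X) · wSum ≡ theta, so the coefficients of wSum are the partial sums 1 + 2 Σ_{1 ≤ j, j² ≤ i} (-1)^j = (-1)^⌊√i⌋.
  wSum-coefficient : ∀ N i j → i ≤ N → j ℕ.* j ≤ i → i < suc j ℕ.* suc j → wSum (suc N) 1 i ≡ sgn j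
  wSum-coefficient N = coefficient
    where
    W : Series
    W = wSum (suc N) 1
    1-X⊛W : ∀ i → i ≤ N → W i +ᶻ -ᶻ shift 1 W i ≡ theta (suc (2* N)) i
    1-X⊛W i i≤N = ≡.trans (≡.sym (1-X⊛-coefficient W i)) (1-X⊛wSum≈[]theta N i i≤N)
    W-suc : ∀ i → suc i ≤ N → W (suc i) ≡ theta (suc (2* N)) (suc i) +ᶻ W i
    W-suc i i<N = ≡.trans (≡.sym (cancel (W (suc i)) (W i))) (≡.cong (_+ᶻ W i) (1-X⊛W (suc i) i<N))
      where
      cancel : ∀ a b → a +ᶻ -ᶻ b +ᶻ b ≡ a
      cancel = ℤ-solve-∀
    coefficient : ∀ i j → i ≤ N → j ℕ.* j ≤ i → i < suc j ℕ.* suc j → W i ≡ sgn j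
    coefficient zero    zero    _ _ _ = ≡.trans (≡.sym (ℤP.+-identityʳ (W 0))) (≡.trans (1-X⊛W 0 z≤n)
      (≡.trans (theta-coefficient (suc (2* N)) 0) (≡.cong (λ c → 1ℤ +ᶻ + 2 *ᶻ c) (thetaSum-nonsquare (suc (2* N)) 0 λ _ _ ()))))
    coefficient (suc i) j i<N j²≤ i<[j+1]² with j ℕ.* j ℕ.≟ suc i
    coefficient (suc i) zero    i<N j²≤ i<[j+1]² | yes ()
    coefficient (suc i) (suc j) i<N j²≤ i<[j+1]² | yes j²≡ = begin
        W (suc i)                                              ≡⟨ W-suc i i<N ⟩
        theta (suc (2* N)) (suc i) +ᶻ W i                      ≡⟨ ≡.cong₂ (λ k w → theta (suc (2* N)) k +ᶻ w) (≡.sym j²≡) previous ⟩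
        theta (suc (2* N)) (suc j ℕ.* suc j) +ᶻ sgn j          ≡⟨ ≡.cong (_+ᶻ sgn j) (≡.trans (theta-coefficient (suc (2* N)) (suc j ℕ.* suc j))
                                                                     (≡.cong (λ c → 0ℤ +ᶻ + 2 *ᶻ c) (thetaSum-square (suc (2* N)) j j<2N+1))) ⟩
        0ℤ +ᶻ + 2 *ᶻ (-ᶻ sgn j) +ᶻ sgn j                      ≡⟨ two-steps-back (sgn j) ⟩
        -ᶻ sgn j                                               ∎
      where
      open ≡.≡-Reasoning
      two-steps-back : ∀ s → 0ℤ +ᶻ + 2 *ᶻ (-ᶻ s) +ᶻ s ≡ -ᶻ s
      two-steps-back = ℤ-solve-∀
      previous : W i ≡ sgn j
      previous = coefficient i j (ℕP.<⇒≤ i<N) (ℕP.≤-pred (≡.subst (suc (j ℕ.* j) ≤_) j²≡ (square-< (ℕP.n<1+n j))))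
                   (≡.subst (i <_) (≡.sym j²≡) ℕP.≤-refl)
      j<2N+1 : j < suc (2* N)
      j<2N+1 = ℕP.<-≤-trans (ℕP.≤-trans (ℕP.m≤m*n (suc j) (suc j)) (ℕP.≤-reflexive j²≡)) (ℕP.≤-trans i<N (ℕP.m≤n⇒m≤1+n (n≤2*n N)))
    coefficient (suc i) j i<N j²≤ i<[j+1]² | no j²≢ = ≡.trans (W-suc i i<N)
      (≡.trans (≡.cong₂ _+ᶻ_ (≡.trans (theta-coefficient (suc (2* N)) (suc i)) (≡.cong (λ c → 0ℤ +ᶻ + 2 *ᶻ c) (thetaSum-nonsquare (suc (2* N)) (suc i) nonsquare)))
                           (coefficient i j (ℕP.<⇒≤ i<N) (ℕP.≤-pred j²<) (ℕP.<-trans (ℕP.n<1+n i) i<[j+1]²)))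
               (ℤP.+-identityˡ (sgn j)))
      where
      j²< : j ℕ.* j < suc i
      j²< = ℕP.≤∧≢⇒< j²≤ j²≢
      nonsquare : ∀ k → k < suc (2* N) → suc k ℕ.* suc k ≢ suc i
      nonsquare k _ eq with ℕP.<-cmp (suc k) j
      ... | tri< k<j _ _  = ℕP.<-irrefl eq (ℕP.<-trans (square-< k<j) j²<)
      ... | tri≈ _ refl _ = j²≢ eq
      ... | tri> _ _ k>j  = ℕP.<-irrefl (≡.sym eq) (ℕP.<-≤-trans i<[j+1]² (ℕP.*-mono-≤ k>j k>j))

  wSum-stable : ∀ N K → suc N ≤ K → wSum K 1 ≈[ N ] wSum (suc N) 1
  wSum-stable N (suc K) (s≤s N≤K) with ℕP.m≤n⇒m<n∨m≡n N≤K
  ... | inj₂ refl = ≈[]-refl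
  ... | inj₁ N<K  = ≈[]-trans (⊕-𝟘[] (const⊛X^⊛≈[]𝟘 (sgn K) (K ℕ.* 2) _ N (ℕP.<-≤-trans N<K (ℕP.m≤m*n K 2)))) (wSum-stable N K N<K)

  -- By signedCount-P34 the left side is -2 times the signed count of 𝒫_{3,4} at N′ + 1.
  two-smallestPartSeries : ∀ N′ j → j ℕ.* j ≤ N′ → N′ < suc j ℕ.* suc j →
    + 2 *ᶻ smallestPartSeries (suc N′) (suc N′) ≡ sgn N′ +ᶻ -ᶻ sgn j
  two-smallestPartSeries N′ j j²≤N′ N′<[j+1]² = begin
      + 2 *ᶻ smallestPartSeries N N                       ≡⟨ ≡.cong (+ 2 *ᶻ_) (smallestTerms≈smallestPartSeries N N) ⟨
      + 2 *ᶻ smallestTerms N N                            ≡⟨ const-⊛ (+ 2) (smallestTerms N) N ⟨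
      (const (+ 2) ⊛ smallestTerms N) N                   ≡⟨ pairing N N ⟩
      oddSum (2* N) N +ᶻ -ᶻ (X^ 1 ⊛ wSum (2* N) 1) N       ≡⟨ ≡.cong₂ (λ u w → u +ᶻ -ᶻ w) (oddSum-coefficient (suc (2* N′)) N′ N≤) (X^⊛≈shift 1 _ N) ⟩
      sgn N′ +ᶻ -ᶻ wSum (2* N) 1 N′                        ≡⟨ ≡.cong (λ w → sgn N′ +ᶻ -ᶻ w) (wSum-stable N′ (2* N) (n<2*[1+n] N′) N′ ℕP.≤-refl) ⟩
      sgn N′ +ᶻ -ᶻ wSum N 1 N′                             ≡⟨ ≡.cong (λ w → sgn N′ +ᶻ -ᶻ w) (wSum-coefficient N′ N′ j ℕP.≤-refl j²≤N′ N′<[j+1]²) ⟩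
      sgn N′ +ᶻ -ᶻ sgn j                                   ∎
    where
    N : ℕ
    N = suc N′
    N≤ : N ≤ 2* suc (suc (2* N′))
    N≤ = ℕP.≤-trans (s≤s (n≤2*n N′)) (ℕP.≤-trans (n≤2*n (suc (2* N′))) (ℕP.m≤n+m _ 2))

module SignedCount where

  open GaussIdentity using (sgn)
  open RestrictedPartitions using (P34-below; P34-enumeration; signedCount-P34; smallestPartSeries)
  open GeneratingFunctions using (2*_; 2*-≡; 2*-even; 2*+1-odd; sgn-2*)
  open Coefficients using (two-smallestPartSeries)
  open import Data.Nat as ℕ using (ℕ; zero; suc; _≤_; _<_; z≤n; s≤s; _%_; _^_; _+_; _*_; _∸_; _<?_)
  import Data.Nat.Properties as ℕP
  open import Data.Nat.Tactic.RingSolver using () renaming (solve to ℕ-solve)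
  open import Data.Integer as ℤ using (ℤ; 0ℤ; 1ℤ; -1ℤ) renaming (_+_ to _+ᶻ_; _*_ to _*ᶻ_; -_ to -ᶻ_)
  import Data.Integer.Properties as ℤP
  open import Data.Integer.Tactic.RingSolver using (solve-∀)
  open import Data.List using (List; []; _∷_)
  open import Data.Product using (_×_; _,_; proj₁; proj₂; ∃-syntax)
  open import Data.Sum using (_⊎_; inj₁; inj₂)
  open import Relation.Binary using (tri<; tri≈; tri>)
  open import Relation.Binary.PropositionalEquality
  open import Relation.Nullary using (¬_; yes; no; contradiction)

  square-≤ : ∀ {j k} → j ≤ k → j * j ≤ k * k
  square-≤ j≤k = ℕP.*-mono-≤ j≤k j≤k

  isqrt : ∀ m → ∃[ j ] (j * j ≤ m × m < suc j * suc j)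
  isqrt zero    = 0 , z≤n , s≤s z≤n
  isqrt (suc m) with isqrt m
  ... | j , j²≤m , m<[j+1]² with suc m <? suc j * suc j
  ...   | yes m+1<[j+1]² = j , ℕP.m≤n⇒m≤1+n j²≤m , m+1<[j+1]²
  ...   | no  m+1≮[j+1]² = suc j , ℕP.≤-reflexive (sym m+1≡[j+1]²) ,
                            subst (_< suc (suc j) * suc (suc j)) (sym m+1≡[j+1]²) (ℕP.*-mono-< (ℕP.n<1+n (suc j)) (ℕP.n<1+n (suc j)))
    where
    m+1≡[j+1]² : suc m ≡ suc j * suc j
    m+1≡[j+1]² = ℕP.≤-antisym m<[j+1]² (ℕP.≮⇒≥ m+1≮[j+1]²)

  isqrt-unique : ∀ {m j k} → j * j ≤ m → m < suc j * suc j → k * k ≤ m → m < suc k * suc k → j ≡ k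
  isqrt-unique {m} {j} {k} j²≤m m<[j+1]² k²≤m m<[k+1]² with ℕP.<-cmp j k
  ... | tri≈ _ j≡k _ = j≡k
  ... | tri< j<k _ _ = contradiction (ℕP.≤-trans (square-≤ j<k) k²≤m) (ℕP.<⇒≱ m<[j+1]²)
  ... | tri> _ _ k<j = contradiction (ℕP.≤-trans (square-≤ k<j) j²≤m) (ℕP.<⇒≱ m<[k+1]²)

  parity-2* : ∀ n → (∃[ h ] n ≡ 2* h) ⊎ (∃[ h ] n ≡ suc (2* h))
  parity-2* zero    = inj₁ (0 , refl)
  parity-2* (suc n) with parity-2* n
  ... | inj₁ (h , refl) = inj₂ (h , refl)
  ... | inj₂ (h , refl) = inj₁ (suc h , refl)

  2*≢2*+1 : ∀ a b → 2* a ≢ suc (2* b)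
  2*≢2*+1 a b eq = contradiction (trans (sym (2*-even a)) (trans (cong (_% 2) eq) (2*+1-odd b))) λ ()

  even-square : ∀ h → ∃[ m ] 2* h * 2* h ≡ 2* m
  even-square h = h * 2* h , square≡
    where
    square≡ : 2* h * 2* h ≡ 2* (h * 2* h)
    square≡ rewrite 2*-≡ h | 2*-≡ (h * (h + h)) = ℕ-solve (h ∷ [])

  odd-square : ∀ h → ∃[ m ] suc (2* h) * suc (2* h) ≡ suc (2* m)
  odd-square h = h * suc (2* h) + h , square≡
    where
    square≡ : suc (2* h) * suc (2* h) ≡ suc (2* (h * suc (2* h) + h))
    square≡ rewrite 2*-≡ h | 2*-≡ (h * suc (h + h) + h) = ℕ-solve (h ∷ [])

  x^2≡x*x : ∀ x → x ^ 2 ≡ x * x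
  x^2≡x*x x = cong (x *_) (ℕP.*-identityʳ x)

  2*ℕ≡2* : ∀ j → 2 * j ≡ 2* j
  2*ℕ≡2* j = trans (cong (j +_) (ℕP.+-identityʳ j)) (sym (2*-≡ j))

  -- With k = ⌊√N′⌋, the three cases of the theorem for N = N′ + 1 are decided by the parities of k and N′.
  module Cases (N′ k : ℕ) (k²≤N′ : k * k ≤ N′) (N′<[k+1]² : N′ < suc k * suc k) where

    N : ℕ
    N = suc N′

    even-case : CaseEven N → sgn k ≡ 1ℤ × sgn N′ ≡ -1ℤ
    even-case (N-even , j , _ , [2j]²<N , N<[2j+1]²) with parity-2* N′
    ... | inj₁ (h , refl) = contradiction N-even (λ N%2≡0 → contradiction (trans (sym (2*+1-odd h)) N%2≡0) λ ())
    ... | inj₂ (h , refl) = trans (cong sgn k≡2*j) (sgn-2* j) , cong -ᶻ_ (sgn-2* h)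
      where
      k≡2*j : k ≡ 2* j
      k≡2*j = isqrt-unique k²≤N′ N′<[k+1]²
        (ℕP.≤-pred (subst (_< N) (trans (x^2≡x*x (2 * j)) (cong (λ r → r * r) (2*ℕ≡2* j))) [2j]²<N))
        (ℕP.<-trans (ℕP.n<1+n N′) (subst (N <_) (trans (x^2≡x*x (2 * j + 1)) (cong (λ r → r * r) (trans (ℕP.+-comm (2 * j) 1) (cong suc (2*ℕ≡2* j))))) N<[2j+1]²))

    odd-case : CaseOdd N → sgn k ≡ -1ℤ × sgn N′ ≡ 1ℤ
    odd-case (N-odd , suc j , _ , [2j-1]²<N , N<[2j]²) with parity-2* N′
    ... | inj₂ (h , refl) = contradiction (trans (sym (2*-even (suc h))) N-odd) λ ()
    ... | inj₁ (h , refl) = trans (cong sgn k≡2*j+1) (cong -ᶻ_ (sgn-2* j)) , sgn-2* h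
      where
      2*[j+1]∸1 : 2 * suc j ∸ 1 ≡ suc (2* j)
      2*[j+1]∸1 = cong (_∸ 1) (2*ℕ≡2* (suc j))
      k≡2*j+1 : k ≡ suc (2* j)
      k≡2*j+1 = isqrt-unique k²≤N′ N′<[k+1]²
        (ℕP.≤-pred (subst (_< N) (trans (x^2≡x*x (2 * suc j ∸ 1)) (cong (λ r → r * r) 2*[j+1]∸1)) [2j-1]²<N))
        (ℕP.<-trans (ℕP.n<1+n N′) (subst (N <_) (trans (x^2≡x*x (2 * suc j)) (cong (λ r → r * r) (2*ℕ≡2* (suc j)))) N<[2j]²))

    neither-case : ¬ CaseEven N → ¬ CaseOdd N → sgn k ≡ sgn N′
    neither-case ¬even ¬odd with parity-2* k | parity-2* N′
    ... | inj₁ (h , refl) | inj₁ (g , refl) = trans (sgn-2* h) (sym (sgn-2* g))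
    ... | inj₂ (h , refl) | inj₂ (g , refl) = cong -ᶻ_ (trans (sgn-2* h) (sym (sgn-2* g)))
    ... | inj₁ (h , refl) | inj₂ (g , refl) = contradiction (2*-even (suc g) , h , 1≤h , [2h]²<N , N<[2h+1]²) ¬even
      where
      1≤h : 1 ≤ h
      1≤h = ℕP.n≢0⇒n>0 λ h≡0 → contradiction (ℕP.n<1⇒n≡0 (subst (λ x → suc (2* g) < suc (2* x) * suc (2* x)) h≡0 N′<[k+1]²)) λ ()
      [2h]²<N : (2 * h) ^ 2 < N
      [2h]²<N = s≤s (subst (_≤ N′) (sym (trans (x^2≡x*x (2 * h)) (cong (λ r → r * r) (2*ℕ≡2* h)))) k²≤N′)
      N<[2h+1]² : N < (2 * h + 1) ^ 2
      N<[2h+1]² = subst (N <_) (sym (trans (x^2≡x*x (2 * h + 1)) (cong (λ r → r * r) (trans (ℕP.+-comm (2 * h) 1) (cong suc (2*ℕ≡2* h))))))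
        (ℕP.≤∧≢⇒< N′<[k+1]² λ N≡ → 2*≢2*+1 (suc g) (proj₁ (odd-square h)) (trans N≡ (proj₂ (odd-square h))))
    ... | inj₂ (h , refl) | inj₁ (g , refl) = contradiction (2*+1-odd g , suc h , s≤s z≤n , [2h+1]²<N , N<[2h+2]²) ¬odd
      where
      [2h+1]²<N : (2 * suc h ∸ 1) ^ 2 < N
      [2h+1]²<N = s≤s (subst (_≤ 2* g) (sym (trans (x^2≡x*x (2 * suc h ∸ 1)) (cong (λ r → r * r) (cong (_∸ 1) (2*ℕ≡2* (suc h)))))) k²≤N′)
      N<[2h+2]² : N < (2 * suc h) ^ 2
      N<[2h+2]² = subst (N <_) (sym (trans (x^2≡x*x (2 * suc h)) (cong (λ r → r * r) (2*ℕ≡2* (suc h)))))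
        (ℕP.≤∧≢⇒< N′<[k+1]² λ N≡ → 2*≢2*+1 (proj₁ (even-square (suc h))) g (sym (trans N≡ (proj₂ (even-square (suc h))))))

  two-signedCount : ∀ N′ {ps} → Enumerates34 (suc N′) ps → ℤ.+ 2 *ᶻ signedCount ps ≡ sgn (proj₁ (isqrt N′)) +ᶻ -ᶻ sgn N′
  two-signedCount N′ {ps} enumerates = begin
      ℤ.+ 2 *ᶻ signedCount ps   ≡⟨ cong (ℤ.+ 2 *ᶻ_) (signedCount-P34 (suc N′) enumerates) ⟩
      ℤ.+ 2 *ᶻ -ᶻ S             ≡⟨ ℤP.neg-distribʳ-* (ℤ.+ 2) S ⟨
      -ᶻ (ℤ.+ 2 *ᶻ S)           ≡⟨ cong -ᶻ_ (two-smallestPartSeries N′ k k²≤N′ N′<[k+1]²) ⟩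
      -ᶻ (sgn N′ +ᶻ -ᶻ sgn k)   ≡⟨ swap (sgn N′) (sgn k) ⟩
      sgn k +ᶻ -ᶻ sgn N′        ∎
    where
    open ≡-Reasoning
    S : ℤ
    S = smallestPartSeries (suc N′) (suc N′)
    k : ℕ
    k = proj₁ (isqrt N′)
    k²≤N′ : k * k ≤ N′
    k²≤N′ = proj₁ (proj₂ (isqrt N′))
    N′<[k+1]² : N′ < suc k * suc k
    N′<[k+1]² = proj₂ (proj₂ (isqrt N′))
    swap : ∀ a b → -ᶻ (a +ᶻ -ᶻ b) ≡ b +ᶻ -ᶻ a
    swap = solve-∀

  signedCount-values : ∀ N′ {ps} → Enumerates34 (suc N′) ps →
    (CaseEven (suc N′) → signedCount ps ≡ 1ℤ) ×
    (CaseOdd (suc N′) → signedCount ps ≡ -1ℤ) ×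
    (¬ CaseEven (suc N′) → ¬ CaseOdd (suc N′) → signedCount ps ≡ 0ℤ)
  signedCount-values N′ {ps} enumerates =
      (λ even → halve (trans (two-signedCount N′ enumerates) (values-even (even-case even))))
    , (λ odd → halve (trans (two-signedCount N′ enumerates) (values-odd (odd-case odd))))
    , (λ ¬even ¬odd → halve (trans (two-signedCount N′ enumerates)
                              (trans (cong (_+ᶻ -ᶻ sgn N′) (neither-case ¬even ¬odd)) (ℤP.+-inverseʳ (sgn N′)))))
    where
    open Cases N′ (proj₁ (isqrt N′)) (proj₁ (proj₂ (isqrt N′))) (proj₂ (proj₂ (isqrt N′)))
    halve : ∀ {v} → ℤ.+ 2 *ᶻ signedCount ps ≡ ℤ.+ 2 *ᶻ v → signedCount ps ≡ v
    halve = ℤP.*-cancelˡ-≡ (ℤ.+ 2) (signedCount ps) _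
    values-even : ∀ {a b} → a ≡ 1ℤ × b ≡ -1ℤ → a +ᶻ -ᶻ b ≡ ℤ.+ 2 *ᶻ 1ℤ
    values-even (refl , refl) = refl
    values-odd : ∀ {a b} → a ≡ -1ℤ × b ≡ 1ℤ → a +ᶻ -ᶻ b ≡ ℤ.+ 2 *ᶻ -1ℤ
    values-odd (refl , refl) = refl

open import Data.Nat using (suc)
open import Data.Product using (_,_)
open RestrictedPartitions using (P34-below; P34-enumeration)
open SignedCount using (signedCount-values)

theorem5p6 : ∀ (N : ℕ) → 1 ≤ N →
    (∃[ ps ] Enumerates34 N ps) ×
    (∀ (ps : List (List ℕ)) → Enumerates34 N ps →
      (CaseEven N → signedCount ps ≡ 1ℤ) ×
      (CaseOdd N → signedCount ps ≡ -1ℤ) ×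
      (¬ CaseEven N → ¬ CaseOdd N → signedCount ps ≡ 0ℤ))
theorem5p6 (suc N′) _ = (P34-below (suc N′) (suc N′) , P34-enumeration (suc N′)) , λ _ → signedCount-values N′
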